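{- Let $D\in\mathbb D$ with $n=\mathrm{ord}_2(D)>0$, and let $L\in\mathcal R_{D,2}$. Then the $2$-glue group of $L(\mathbb Z_2)$ is isomorphic (as an abelian group) to $\mathbb Z/2\mathbb Z\times\mathbb Z/2^{n-1}\mathbb Z$.
   Context: $\mathbb D=\{D\in\mathbb N:D\not\equiv0,7,12,15\bmod16\}$. $\mathbf D$ is the Hamiltonian quaternion algebra over $\mathbb Q$ with basis $1,\mathrm i,\mathrm j,\mathrm k$, conjugation $\overline x$, trace $\mathrm{Tr}(x)=x+\overline x$, norm $Q(x)=x\overline x=\sum x_i^2$ and bilinear form $\langle x,y\rangle=\tfrac12\mathrm{Tr}(x\overline y)$; $\mathbf D(\mathbb Q_2)\cong\mathbb Q_2^4$. For a 2-dimensional subspace $L\subset\mathbb Q_2^4$: $L(\mathbb Z_2)=L\cap\mathbb Z_2^4$ and $\mathrm{disc}(L)$ is the Gram determinant of $\langle\cdot,\cdot\rangle$ on a $\mathbb Z_2$-basis of $L(\mathbb Z_2)$; $\mathcal R_{D,2}$ is the set of such $L$ with $\mathrm{disc}(L)\in D(\mathbb Z_2^\times)^2$. The $2$-glue group of a $\mathbb Z_2$-lattice $\Lambda$ is $\Lambda^\#/\Lambda$ with $\Lambda^\#=\{v\in\Lambda\otimes\mathbb Q_2:\langle v,w\rangle\in\mathbb Z_2\ \forall w\in\Lambda\}$. -}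

module Defs where

open import Data.Nat as ℕ using (ℕ; zero; suc; _%_)
import Data.Nat.Divisibility as ℕD
open import Data.Integer as ℤ using (ℤ; +_; _+_; _*_; _-_; -_)
open import Data.Integer.Tactic.RingSolver using (solve-∀)
open import Data.Fin using (Fin; zero; suc)
open import Data.Product using (Σ; Σ-syntax; ∃; _×_; _,_; proj₁; proj₂)
open import Function.Bundles using (_⇔_)
open import Relation.Nullary using (¬_)
open import Relation.Binary.PropositionalEquality using (_≡_; refl; trans; sym; cong₂; cong)

2^ : ℕ → ℤ
2^ k = + (2 ℕ.^ k)

Div : ℕ → ℤ → Set
Div k z = Σ ℤ λ c → z ≡ c * 2^ k

private
  l+ : ∀ x' x y' y → (x' + y') - (x + y) ≡ (x' - x) + (y' - y)
  l+ = solve-∀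
  l* : ∀ x' x y' y → (x' * y') - (x * y) ≡ x' * (y' - y) + (x' - x) * y
  l* = solve-∀
  l- : ∀ x' x → (- x') - (- x) ≡ - (x' - x)
  l- = solve-∀
  l0 : ∀ c (p : ℤ) → c - c ≡ + 0 * p
  l0 = solve-∀
  dadd : ∀ a b p → a * p + b * p ≡ (a + b) * p
  dadd = solve-∀
  dmul : ∀ u a v b p → u * (a * p) + (b * p) * v ≡ (u * a + b * v) * p
  dmul = solve-∀
  dneg : ∀ a p → - (a * p) ≡ (- a) * p
  dneg = solve-∀

-- The 2-adic integers ℤ₂ as the inverse limit of ℤ/2^k:
-- coherent sequences (x_k) with x_{k+1} ≡ x_k mod 2^k,
-- with equality  x ≈ y  iff  x_k ≡ y_k mod 2^k for all k.

record Z2 : Set where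
  constructor mkZ2
  field
    seq : ℕ → ℤ
    coh : ∀ k → Div k (seq (suc k) - seq k)
open Z2 public

_≈Z_ : Z2 → Z2 → Set
x ≈Z y = ∀ k → Div k (seq x k - seq y k)

fromℤ : ℤ → Z2
fromℤ c = mkZ2 (λ _ → c) (λ k → + 0 , l0 c (2^ k))

_+Z_ : Z2 → Z2 → Z2
x +Z y = mkZ2 (λ k → seq x k + seq y k) pf
  where
  pf : ∀ k → Div k ((seq x (suc k) + seq y (suc k)) - (seq x k + seq y k))
  pf k with coh x k | coh y k
  ... | a , p | b , q = a + b ,
        trans (l+ (seq x (suc k)) (seq x k) (seq y (suc k)) (seq y k)) (trans (cong₂ _+_ p q) (dadd a b (2^ k)))

_*Z_ : Z2 → Z2 → Z2
x *Z y = mkZ2 (λ k → seq x k * seq y k) pf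
  where
  pf : ∀ k → Div k ((seq x (suc k) * seq y (suc k)) - (seq x k * seq y k))
  pf k with coh x k | coh y k
  ... | a , p | b , q = seq x (suc k) * b + a * seq y k ,
        trans (l* (seq x (suc k)) (seq x k) (seq y (suc k)) (seq y k))
          (trans (cong₂ (λ s t → seq x (suc k) * s + t * seq y k) q p)
                 (dmul (seq x (suc k)) b (seq y k) a (2^ k)))

-Z_ : Z2 → Z2
-Z x = mkZ2 (λ k → - seq x k) pf
  where
  pf : ∀ k → Div k ((- seq x (suc k)) - (- seq x k))
  pf k with coh x k
  ... | a , p = - a , trans (l- (seq x (suc k)) (seq x k)) (trans (cong -_ p) (dneg a (2^ k)))

IsUnitZ : Z2 → Set
IsUnitZ x = ¬ Div 1 (seq x 1)

pow2Z : ℕ → Z2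
pow2Z m = fromℤ (2^ m)

-- ℚ₂ as fractions  num / 2^ex  with num ∈ ℤ₂

record Q2 : Set where
  constructor mkQ2
  field
    num : Z2
    ex  : ℕ
open Q2 public

_≈Q_ : Q2 → Q2 → Set
p ≈Q q = (num p *Z pow2Z (ex q)) ≈Z (num q *Z pow2Z (ex p))

ι : Z2 → Q2
ι x = mkQ2 x 0

0Q : Q2
0Q = ι (fromℤ (+ 0))

_+Q_ : Q2 → Q2 → Q2
p +Q q = mkQ2 ((num p *Z pow2Z (ex q)) +Z (num q *Z pow2Z (ex p))) (ex p ℕ.+ ex q)

_*Q_ : Q2 → Q2 → Q2
p *Q q = mkQ2 (num p *Z num q) (ex p ℕ.+ ex q)

-Q_ : Q2 → Q2
-Q p = mkQ2 (-Z num p) (ex p)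

_-Q_ : Q2 → Q2 → Q2
p -Q q = p +Q (-Q q)

IsIntQ : Q2 → Set
IsIntQ q = Σ Z2 λ c → (c *Z pow2Z (ex q)) ≈Z num q

-- 𝐃(ℚ₂) ≅ ℚ₂⁴ (coordinates w.r.t. 1, i, j, k)

V4 : Set
V4 = Fin 4 → Q2

_≈V_ : V4 → V4 → Set
x ≈V y = ∀ i → x i ≈Q y i

_+V_ : V4 → V4 → V4
(x +V y) i = x i +Q y i

_-V_ : V4 → V4 → V4
(x -V y) i = x i -Q y i

_·V_ : Q2 → V4 → V4
(a ·V x) i = a *Q x i

0V : V4
0V _ = 0Q

-- ⟨x,y⟩ = ½ Tr(x ȳ) = real part of x ȳ = Σ xᵢ yᵢ
⟨_,_⟩ : V4 → V4 → Q2
⟨ x , y ⟩ = (x zero *Q y zero) +Q ((x (suc zero) *Q y (suc zero))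
            +Q ((x (suc (suc zero)) *Q y (suc (suc zero)))
            +Q (x (suc (suc (suc zero))) *Q y (suc (suc (suc zero))))))

-- A 2-dimensional subspace L ⊂ ℚ₂⁴, given by a pair of ℚ₂-linearly
-- independent spanning vectors u, v.

LinIndepQ : V4 → V4 → Set
LinIndepQ u v = ∀ (a b : Q2) → ((a ·V u) +V (b ·V v)) ≈V 0V → (a ≈Q 0Q) × (b ≈Q 0Q)

InL : V4 → V4 → V4 → Set
InL u v x = Σ Q2 λ a → Σ Q2 λ b → x ≈V ((a ·V u) +V (b ·V v))

IntegralV : V4 → Set
IntegralV x = ∀ i → IsIntQ (x i)

InLZ : V4 → V4 → V4 → Set
InLZ u v x = InL u v x × IntegralV x

IsZ2Basis : V4 → V4 → V4 → V4 → Set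
IsZ2Basis u v e f =
  InLZ u v e × InLZ u v f ×
  (∀ w → InLZ u v w → Σ Z2 λ α → Σ Z2 λ β → w ≈V ((ι α ·V e) +V (ι β ·V f))) ×
  (∀ (α β : Z2) → ((ι α ·V e) +V (ι β ·V f)) ≈V 0V → (α ≈Z fromℤ (+ 0)) × (β ≈Z fromℤ (+ 0)))

gramDet : V4 → V4 → Q2
gramDet e f = (⟨ e , e ⟩ *Q ⟨ f , f ⟩) -Q (⟨ e , f ⟩ *Q ⟨ e , f ⟩)

InRD2 : ℕ → V4 → V4 → Set
InRD2 D u v = Σ V4 λ e → Σ V4 λ f → IsZ2Basis u v e f ×
  (Σ Z2 λ t → IsUnitZ t × (gramDet e f ≈Q ι (fromℤ (+ D) *Z (t *Z t))))

InDD : ℕ → Set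
InDD D = ¬ (D % 16 ≡ 0) × ¬ (D % 16 ≡ 7) × ¬ (D % 16 ≡ 12) × ¬ (D % 16 ≡ 15)

Ord2 : ℕ → ℕ → Set
Ord2 D n = (2 ℕ.^ n ℕD.∣ D) × ¬ (2 ℕ.^ suc n ℕD.∣ D)

-- 2-glue group Λ^# / Λ for Λ = L(ℤ₂); Λ ⊗ ℚ₂ = L.

InDual : V4 → V4 → V4 → Set
InDual u v x = InL u v x × (∀ w → InLZ u v w → IsIntQ ⟨ x , w ⟩)

Dual : V4 → V4 → Set
Dual u v = Σ V4 (InDual u v)

-- ℤ/2ℤ × ℤ/2^m ℤ, as ℤ × ℤ modulo the obvious congruence
_≈T[_]_ : ℤ × ℤ → ℕ → ℤ × ℤ → Set
(a , b) ≈T[ m ] (a' , b') = Div 1 (a - a') × Div m (b - b')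

_+T_ : ℤ × ℤ → ℤ × ℤ → ℤ × ℤ
(a , b) +T (a' , b') = (a + a' , b + b')

-- Λ^#/Λ ≅ ℤ/2 × ℤ/2^m as abelian groups: a map φ on Λ^# inducing a
-- well-defined, injective, additive, surjective map on Λ^#/Λ.
GlueIso : V4 → V4 → ℕ → Set
GlueIso u v m = Σ (Dual u v → ℤ × ℤ) λ φ →
  (∀ (x y : Dual u v) → InLZ u v (proj₁ x -V proj₁ y) ⇔ (φ x ≈T[ m ] φ y)) ×
  (∀ (x y z : Dual u v) → proj₁ z ≈V (proj₁ x +V proj₁ y) → φ z ≈T[ m ] (φ x +T φ y)) ×
  (∀ (t : ℤ × ℤ) → Σ (Dual u v) λ x → φ x ≈T[ m ] t)

-- Let e, f be a ℤ₂-basis of Λ = L(ℤ₂) with Gram matrix G = [[A, B], [B, C]] and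
-- Δ = det G = 2ⁿ·δ, δ a unit.  The pairings x ↦ (⟨x, e⟩, ⟨x, f⟩) identify Λ^# with
-- ℤ₂² and Λ with G·ℤ₂², so Λ^#/Λ ≅ ℤ₂²/G·ℤ₂².  Since 16 ∤ D we have n ≤ 3, so all
-- congruences can be read modulo 16.  For n = 1 a diagonal entry of G is odd and the
-- cokernel is ℤ/2.  For n ≥ 2 the saturation of Λ = L ∩ ℤ₂⁴ forces G ≡ 0 mod 2, so
-- G = 2G′ with det G′ = 2^(n-2)·δ, and the cokernel is (ℤ/2)² for n = 2 and ℤ/2 × ℤ/4
-- for n = 3.  In each case the isomorphism is given by explicit linear forms in the
-- two pairings.

module Submission where

open import Defs
open import Data.Nat using (ℕ; _<_; _∸_)
open import Data.Nat as ℕ using (suc; zero; _≤_; s≤s; z≤n)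
open import Data.Integer as ℤ using (ℤ; +_; -[1+_]; _+_; _*_; _-_; -_)
import Data.Nat.Properties as ℕP
import Data.Integer.Properties as ℤP
import Data.Integer.DivMod as ℤD
import Data.Nat.Divisibility as ℕD
open import Data.Integer.Tactic.RingSolver using (solve-∀)
open import Data.Nat.Tactic.RingSolver using () renaming (solve-∀ to ℕ-solve-∀)
open import Data.Fin using (Fin; zero; suc)
open import Data.Product using (Σ; _×_; _,_; proj₁; proj₂)
open import Data.Sum using (_⊎_; inj₁; inj₂; [_,_]′)
open import Data.Empty using (⊥; ⊥-elim)
open import Data.Maybe using (Maybe; just; nothing)
open import Function using (_∘′_)
open import Function.Bundles using (mk⇔)
open import Relation.Nullary using (¬_; yes; no)
open import Relation.Binary.PropositionalEquality
open import Relation.Binary.Structures using (IsEquivalence)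
open import Algebra.Structures using (IsCommutativeSemiring)
open import Algebra.Solver.Ring.AlmostCommutativeRing
import Algebra.Solver.Ring as RingSolver

-- Congruences modulo powers of two

2^-nonZero : ∀ k → ℤ.NonZero (2^ k)
2^-nonZero k = ℕP.m^n≢0 2 k

2^-+ : ∀ a b → 2^ (a ℕ.+ b) ≡ 2^ a * 2^ b
2^-+ a b = trans (cong +_ (ℕP.^-distribˡ-+-* 2 a b)) (ℤP.pos-* (2 ℕ.^ a) (2 ℕ.^ b))

Div-zero : ∀ k → Div k (+ 0)
Div-zero k = + 0 , refl

Div-2^0 : ∀ z → Div 0 z
Div-2^0 z = z , sym (ℤP.*-identityʳ z)

Div-2^ : ∀ k → Div k (2^ k)
Div-2^ k = + 1 , sym (ℤP.*-identityˡ (2^ k))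

Div-+ : ∀ k {a b} → Div k a → Div k b → Div k (a + b)
Div-+ k (c , p) (d , q) = c + d , trans (cong₂ _+_ p q) (sym (ℤP.*-distribʳ-+ (2^ k) c d))

Div-neg : ∀ k {a} → Div k a → Div k (- a)
Div-neg k (c , p) = - c , trans (cong -_ p) (ℤP.neg-distribˡ-* c (2^ k))

Div-minus : ∀ k {a b} → Div k a → Div k b → Div k (a - b)
Div-minus k da db = Div-+ k da (Div-neg k db)

Div-*ˡ : ∀ k {a} b → Div k a → Div k (b * a)
Div-*ˡ k b (c , p) = b * c , trans (cong (b *_) p) (sym (ℤP.*-assoc b c (2^ k)))

Div-*ʳ : ∀ k {a} b → Div k a → Div k (a * b)
Div-*ʳ k {a} b d = subst (Div k) (ℤP.*-comm b a) (Div-*ˡ k b d)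

Div-* : ∀ j k {a b} → Div j a → Div k b → Div (j ℕ.+ k) (a * b)
Div-* j k (c , p) (d , q) = c * d , trans (cong₂ _*_ p q)
  (trans (interchange c (2^ j) d (2^ k)) (cong ((c * d) *_) (sym (2^-+ j k))))
  where
  interchange : ∀ c x d y → (c * x) * (d * y) ≡ (c * d) * (x * y)
  interchange = solve-∀

Div-mono : ∀ j k {a} → j ≤ k → Div k a → Div j a
Div-mono j k j≤k (c , p) with ℕP.m≤n⇒∃[o]m+o≡n j≤k
... | o , refl = c * 2^ o , trans p (trans (cong (c *_) (trans (2^-+ j o) (ℤP.*-comm (2^ j) (2^ o))))
                                           (sym (ℤP.*-assoc c (2^ o) (2^ j))))

Div-*2^-cancel : ∀ k {a} m → Div (k ℕ.+ m) (a * 2^ m) → Div k a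
Div-*2^-cancel k {a} m (c , p) = c , ℤP.*-cancelʳ-≡ a (c * 2^ k) (2^ m) {{2^-nonZero m}}
   (trans p (trans (cong (c *_) (2^-+ k m)) (sym (ℤP.*-assoc c (2^ k) (2^ m)))))

Div-2^*-cancel : ∀ k {a} m → Div (m ℕ.+ k) (2^ m * a) → Div k a
Div-2^*-cancel k {a} m d = Div-*2^-cancel k m
  (subst (Div (k ℕ.+ m)) (ℤP.*-comm (2^ m) a) (subst (λ j → Div j (2^ m * a)) (ℕP.+-comm m k) d))

-- Congruence mod 2^k, like the equalities ≃Z, ≃Q, ≃V below that wrap ≈Z, ≈Q, ≈V of Defs,
-- is a record so that both sides can be recovered from a proof by unification.
record Cong (k : ℕ) (a b : ℤ) : Set where
  constructor by-div
  field
    div : Div k (a - b)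
open Cong public

Cong-reflexive : ∀ k {a b} → a ≡ b → Cong k a b
Cong-reflexive k {a} refl = by-div (subst (Div k) (sym (ℤP.+-inverseʳ a)) (Div-zero k))

Cong-refl : ∀ k a → Cong k a a
Cong-refl k a = Cong-reflexive k refl

Cong-sym : ∀ k {a b} → Cong k a b → Cong k b a
Cong-sym k {a} {b} (by-div d) = by-div (subst (Div k) (negate-diff a b) (Div-neg k d))
  where
  negate-diff : ∀ a b → - (a - b) ≡ b - a
  negate-diff = solve-∀

Cong-trans : ∀ k {a b c} → Cong k a b → Cong k b c → Cong k a c
Cong-trans k {a} {b} {c} (by-div d) (by-div e) = by-div (subst (Div k) (telescope a b c) (Div-+ k d e))
  where
  telescope : ∀ a b c → (a - b) + (b - c) ≡ a - c
  telescope = solve-∀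

Cong-resp-≡ : ∀ k {a a' b b'} → a ≡ a' → b ≡ b' → Cong k a' b' → Cong k a b
Cong-resp-≡ k refl refl c = c

Cong-mono : ∀ j k {a b} → j ≤ k → Cong k a b → Cong j a b
Cong-mono j k j≤k (by-div d) = by-div (Div-mono j k j≤k d)

Cong-+ : ∀ k {a a' b b'} → Cong k a a' → Cong k b b' → Cong k (a + b) (a' + b')
Cong-+ k {a} {a'} {b} {b'} (by-div p) (by-div q) = by-div (subst (Div k) (diff-+ a a' b b') (Div-+ k p q))
  where
  diff-+ : ∀ a a' b b' → (a - a') + (b - b') ≡ (a + b) - (a' + b')
  diff-+ = solve-∀

Cong-* : ∀ k {a a' b b'} → Cong k a a' → Cong k b b' → Cong k (a * b) (a' * b')
Cong-* k {a} {a'} {b} {b'} (by-div p) (by-div q) =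
  by-div (subst (Div k) (diff-* a a' b b') (Div-+ k (Div-*ʳ k b p) (Div-*ˡ k a' q)))
  where
  diff-* : ∀ a a' b b' → (a - a') * b + a' * (b - b') ≡ (a * b) - (a' * b')
  diff-* = solve-∀

Cong-neg : ∀ k {a a'} → Cong k a a' → Cong k (- a) (- a')
Cong-neg k {a} {a'} (by-div p) = by-div (subst (Div k) (diff-neg a a') (Div-neg k p))
  where
  diff-neg : ∀ a a' → - (a - a') ≡ (- a) - (- a')
  diff-neg = solve-∀

Div-resp-Cong : ∀ k {a b} → Cong k a b → Div k b → Div k a
Div-resp-Cong k {a} {b} (by-div d) db = subst (Div k) (cancel a b) (Div-+ k d db)
  where
  cancel : ∀ a b → (a - b) + b ≡ a
  cancel = solve-∀

Odd : ℤ → Set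
Odd z = Σ ℤ λ c → z ≡ c * + 2 + + 1

odd⇒¬even : ∀ {z} → Odd z → ¬ Div 1 z
odd⇒¬even {z} (c , p) (d , q) = 1-odd (d - c) (trans (one c) (trans (cong (_- (c * + 2)) (trans (sym p) q)) (factor d c)))
  where
  1-odd : ∀ e → ¬ (+ 1 ≡ e * + 2)
  1-odd (+ zero) ()
  1-odd (+ suc zero) ()
  1-odd (+ suc (suc n)) ()
  1-odd -[1+ n ] ()
  one : ∀ c → + 1 ≡ (c * + 2 + + 1) - c * + 2
  one = solve-∀
  factor : ∀ d c → d * + 2 - c * + 2 ≡ (d - c) * + 2
  factor = solve-∀

parity : ∀ z → Div 1 z ⊎ Odd z
parity z with ℤD.a≡a%n+[a/n]*n z (+ 2) | ℤD.n%d<d z (+ 2)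
... | z≡ | z%2<2 with z ℤ.% + 2
... | zero = inj₁ (z ℤ./ + 2 , trans z≡ (ℤP.+-identityˡ _))
... | suc zero = inj₂ (z ℤ./ + 2 , trans z≡ (ℤP.+-comm (+ 1) ((z ℤ./ + 2) * + 2)))
... | suc (suc r) = ⊥-elim (ℕP.<-irrefl refl (ℕP.≤-trans z%2<2 (s≤s (s≤s z≤n))))

¬even⇒odd : ∀ {z} → ¬ Div 1 z → Odd z
¬even⇒odd {z} ¬ev with parity z
... | inj₁ ev = ⊥-elim (¬ev ev)
... | inj₂ o = o

odd-* : ∀ {u v} → ¬ Div 1 u → ¬ Div 1 v → ¬ Div 1 (u * v)
odd-* {u} {v} ¬ev-u ¬ev-v with ¬even⇒odd ¬ev-u | ¬even⇒odd ¬ev-v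
... | a , refl | b , refl = odd⇒¬even (a * b * + 2 + a + b , expand a b)
  where
  expand : ∀ a b → (a * + 2 + + 1) * (b * + 2 + + 1) ≡ (a * b * + 2 + a + b) * + 2 + + 1
  expand = solve-∀

Div-cancel-odd : ∀ k {u z} → ¬ Div 1 u → Div k (u * z) → Div k z
Div-cancel-odd zero {u} {z} _ _ = Div-2^0 z
Div-cancel-odd (suc k) {u} {z} ¬ev-u d with parity z
... | inj₂ odd-z = ⊥-elim (odd-* ¬ev-u (odd⇒¬even odd-z) (Div-mono 1 (suc k) (s≤s z≤n) d))
... | inj₁ (c , refl) = subst (Div (suc k)) (ℤP.*-comm (+ 2) c) (double (Div-cancel-odd k ¬ev-u half))
  where
  half : Div k (u * c)
  half = Div-2^*-cancel k 1 (subst (Div (suc k)) (reassoc u c) d)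
    where
    reassoc : ∀ u c → u * (c * + 2) ≡ + 2 * (u * c)
    reassoc = solve-∀
  double : Div k c → Div (suc k) (+ 2 * c)
  double (e , p) = e , trans (cong (+ 2 *_) p) (trans (swap e (2^ k)) (cong (e *_) (sym (ℤP.pos-* 2 (2 ℕ.^ k)))))
    where
    swap : ∀ e x → + 2 * (e * x) ≡ e * (+ 2 * x)
    swap = solve-∀

odd-square : ∀ {s} → ¬ Div 1 s → Div 2 (s * s - + 1)
odd-square {s} ¬ev with ¬even⇒odd ¬ev
... | c , refl = c * c + c , expand c
  where
  expand : ∀ c → (c * + 2 + + 1) * (c * + 2 + + 1) - + 1 ≡ (c * c + c) * + 4
  expand = solve-∀

Cong-*2^-cancel : ∀ k m {a b} → Cong (k ℕ.+ m) (a * 2^ m) (b * 2^ m) → Cong k a b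
Cong-*2^-cancel k m {a} {b} (by-div d) = by-div (Div-*2^-cancel k m (subst (Div (k ℕ.+ m)) (factor a b (2^ m)) d))
  where
  factor : ∀ a b x → a * x - b * x ≡ (a - b) * x
  factor = solve-∀

sum4 : ℤ → ℤ → ℤ → ℤ → ℤ
sum4 a b c d = a + (b + (c + d))

Cong-sum4 : ∀ k {a a' b b' c c' d d'} → Cong k a a' → Cong k b b' → Cong k c c' → Cong k d d' →
            Cong k (sum4 a b c d) (sum4 a' b' c' d')
Cong-sum4 k p q r s = Cong-+ k p (Cong-+ k q (Cong-+ k r s))

square-even : ∀ {g} → Div 1 g → Cong 2 (g * g) (+ 0)
square-even {g} (c , refl) = by-div (c * c , expand c)
  where
  expand : ∀ c → c * + 2 * (c * + 2) - + 0 ≡ c * c * + 4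
  expand = solve-∀

square-odd : ∀ {g} → Odd g → Cong 2 (g * g) (+ 1)
square-odd {g} (c , refl) = by-div (c * c + c , expand c)
  where
  expand : ∀ c → (c * + 2 + + 1) * (c * + 2 + + 1) - + 1 ≡ (c * c + c) * + 4
  expand = solve-∀

square-Cong-self : ∀ e → Cong 1 (e * e) e
square-Cong-self e with parity e
... | inj₁ (c , refl) = by-div (c * c * + 2 - c , expand c)
  where
  expand : ∀ c → c * + 2 * (c * + 2) - c * + 2 ≡ (c * c * + 2 - c) * + 2
  expand = solve-∀
... | inj₂ (c , refl) = by-div (c * c * + 2 + c , expand c)
  where
  expand : ∀ c → (c * + 2 + + 1) * (c * + 2 + + 1) - (c * + 2 + + 1) ≡ (c * c * + 2 + c) * + 2
  expand = solve-∀

odd-*-Cong : ∀ {g} e → Odd g → Cong 1 (g * e) e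
odd-*-Cong {g} e (c , refl) = by-div (c * e , expand c e)
  where
  expand : ∀ c e → (c * + 2 + + 1) * e - e ≡ c * e * + 2
  expand = solve-∀

-- If Σ gᵢ² ≡ 0 mod 4 then the gᵢ are all even or all odd; when Σ eᵢ² is odd,
-- all odd would make Σ gᵢ eᵢ ≡ Σ eᵢ² odd, so Σ gᵢ eᵢ = 0 forces all even.
four-squares-even : ∀ g0 g1 g2 g3 e0 e1 e2 e3 →
  Div 2 (sum4 (g0 * g0) (g1 * g1) (g2 * g2) (g3 * g3)) →
  sum4 (g0 * e0) (g1 * e1) (g2 * e2) (g3 * e3) ≡ + 0 →
  ¬ Div 1 (sum4 (e0 * e0) (e1 * e1) (e2 * e2) (e3 * e3)) →
  Div 1 g0 × Div 1 g1 × Div 1 g2 × Div 1 g3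
four-squares-even g0 g1 g2 g3 e0 e1 e2 e3 4∣Σg² Σge≡0 Σe²-odd =
  cases (parity g0) (parity g1) (parity g2) (parity g3)
  where
  ¬4∣1 : ¬ Div 2 (+ 1)
  ¬4∣1 (+ zero , ())
  ¬4∣1 (+ suc n , ())
  ¬4∣1 (-[1+ n ] , ())
  ¬4∣2 : ¬ Div 2 (+ 2)
  ¬4∣2 (+ zero , ())
  ¬4∣2 (+ suc n , ())
  ¬4∣2 (-[1+ n ] , ())
  ¬4∣3 : ¬ Div 2 (+ 3)
  ¬4∣3 (+ zero , ())
  ¬4∣3 (+ suc n , ())
  ¬4∣3 (-[1+ n ] , ())
  mixed : ∀ {s} → ¬ Div 2 s → Cong 2 (sum4 (g0 * g0) (g1 * g1) (g2 * g2) (g3 * g3)) s → ⊥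
  mixed ¬4∣s c = ¬4∣s (Div-resp-Cong 2 (Cong-sym 2 c) 4∣Σg²)
  all-odd : Odd g0 → Odd g1 → Odd g2 → Odd g3 → ⊥
  all-odd o0 o1 o2 o3 = Σe²-odd (Div-resp-Cong 1 (Cong-trans 1
    (Cong-sum4 1 (square-Cong-self e0) (square-Cong-self e1) (square-Cong-self e2) (square-Cong-self e3))
    (Cong-trans 1 (Cong-sym 1 (Cong-sum4 1 (odd-*-Cong e0 o0) (odd-*-Cong e1 o1) (odd-*-Cong e2 o2) (odd-*-Cong e3 o3)))
      (Cong-reflexive 1 Σge≡0))) (Div-zero 1))
  cases : Div 1 g0 ⊎ Odd g0 → Div 1 g1 ⊎ Odd g1 → Div 1 g2 ⊎ Odd g2 → Div 1 g3 ⊎ Odd g3 →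
          Div 1 g0 × Div 1 g1 × Div 1 g2 × Div 1 g3
  cases (inj₁ d0) (inj₁ d1) (inj₁ d2) (inj₁ d3) = d0 , d1 , d2 , d3
  cases (inj₁ d0) (inj₁ d1) (inj₁ d2) (inj₂ o3) = ⊥-elim (mixed ¬4∣1 (Cong-sum4 2 (square-even d0) (square-even d1) (square-even d2) (square-odd o3)))
  cases (inj₁ d0) (inj₁ d1) (inj₂ o2) (inj₁ d3) = ⊥-elim (mixed ¬4∣1 (Cong-sum4 2 (square-even d0) (square-even d1) (square-odd o2) (square-even d3)))
  cases (inj₁ d0) (inj₁ d1) (inj₂ o2) (inj₂ o3) = ⊥-elim (mixed ¬4∣2 (Cong-sum4 2 (square-even d0) (square-even d1) (square-odd o2) (square-odd o3)))
  cases (inj₁ d0) (inj₂ o1) (inj₁ d2) (inj₁ d3) = ⊥-elim (mixed ¬4∣1 (Cong-sum4 2 (square-even d0) (square-odd o1) (square-even d2) (square-even d3)))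
  cases (inj₁ d0) (inj₂ o1) (inj₁ d2) (inj₂ o3) = ⊥-elim (mixed ¬4∣2 (Cong-sum4 2 (square-even d0) (square-odd o1) (square-even d2) (square-odd o3)))
  cases (inj₁ d0) (inj₂ o1) (inj₂ o2) (inj₁ d3) = ⊥-elim (mixed ¬4∣2 (Cong-sum4 2 (square-even d0) (square-odd o1) (square-odd o2) (square-even d3)))
  cases (inj₁ d0) (inj₂ o1) (inj₂ o2) (inj₂ o3) = ⊥-elim (mixed ¬4∣3 (Cong-sum4 2 (square-even d0) (square-odd o1) (square-odd o2) (square-odd o3)))
  cases (inj₂ o0) (inj₁ d1) (inj₁ d2) (inj₁ d3) = ⊥-elim (mixed ¬4∣1 (Cong-sum4 2 (square-odd o0) (square-even d1) (square-even d2) (square-even d3)))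
  cases (inj₂ o0) (inj₁ d1) (inj₁ d2) (inj₂ o3) = ⊥-elim (mixed ¬4∣2 (Cong-sum4 2 (square-odd o0) (square-even d1) (square-even d2) (square-odd o3)))
  cases (inj₂ o0) (inj₁ d1) (inj₂ o2) (inj₁ d3) = ⊥-elim (mixed ¬4∣2 (Cong-sum4 2 (square-odd o0) (square-even d1) (square-odd o2) (square-even d3)))
  cases (inj₂ o0) (inj₁ d1) (inj₂ o2) (inj₂ o3) = ⊥-elim (mixed ¬4∣3 (Cong-sum4 2 (square-odd o0) (square-even d1) (square-odd o2) (square-odd o3)))
  cases (inj₂ o0) (inj₂ o1) (inj₁ d2) (inj₁ d3) = ⊥-elim (mixed ¬4∣2 (Cong-sum4 2 (square-odd o0) (square-odd o1) (square-even d2) (square-even d3)))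
  cases (inj₂ o0) (inj₂ o1) (inj₁ d2) (inj₂ o3) = ⊥-elim (mixed ¬4∣3 (Cong-sum4 2 (square-odd o0) (square-odd o1) (square-even d2) (square-odd o3)))
  cases (inj₂ o0) (inj₂ o1) (inj₂ o2) (inj₁ d3) = ⊥-elim (mixed ¬4∣3 (Cong-sum4 2 (square-odd o0) (square-odd o1) (square-odd o2) (square-even d3)))
  cases (inj₂ o0) (inj₂ o1) (inj₂ o2) (inj₂ o3) = ⊥-elim (all-odd o0 o1 o2 o3)

-- The 2-adic integers and numbers

seq-coherent : ∀ x j m → j ≤ m → Cong j (seq x m) (seq x j)
seq-coherent x j m j≤m with ℕP.m≤n⇒∃[o]m+o≡n j≤m
... | o , refl = subst (λ i → Cong j (seq x i) (seq x j)) (ℕP.+-comm o j) (steps o)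
  where
  steps : ∀ d → Cong j (seq x (d ℕ.+ j)) (seq x j)
  steps zero = Cong-refl j (seq x j)
  steps (suc d) = Cong-trans j (Cong-mono j (d ℕ.+ j) (ℕP.m≤n+m j d) (by-div (coh x (d ℕ.+ j)))) (steps d)

Div-seq : ∀ z j {m m'} → j ≤ m → j ≤ m' → Div j (seq z m) → Div j (seq z m')
Div-seq z j {m} {m'} j≤m j≤m' =
  Div-resp-Cong j (Cong-trans j (seq-coherent z j m' j≤m') (Cong-sym j (seq-coherent z j m j≤m)))

unit-seq-odd : ∀ t m → IsUnitZ t → 1 ≤ m → ¬ Div 1 (seq t m)
unit-seq-odd t m unit 1≤m = unit ∘′ Div-seq t 1 1≤m ℕP.≤-refl

infix 4 _≃Z_
record _≃Z_ (x y : Z2) : Set where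
  constructor ez
  field
    at : ∀ k → Cong k (seq x k) (seq y k)
open _≃Z_ public

≈Z⇒≃Z : ∀ {x y} → x ≈Z y → x ≃Z y
≈Z⇒≃Z p = ez (λ k → by-div (p k))

≃Z-refl : ∀ x → x ≃Z x
≃Z-refl x = ez (λ k → Cong-refl k (seq x k))

≃Z-sym : ∀ {x y} → x ≃Z y → y ≃Z x
≃Z-sym (ez p) = ez (λ k → Cong-sym k (p k))

≃Z-trans : ∀ {x y z} → x ≃Z y → y ≃Z z → x ≃Z z
≃Z-trans (ez p) (ez q) = ez (λ k → Cong-trans k (p k) (q k))

≃Z-pointwise : ∀ {x y} → (∀ k → seq x k ≡ seq y k) → x ≃Z y
≃Z-pointwise e = ez (λ k → Cong-reflexive k (e k))

*Z-cong : ∀ {x x' y y'} → x ≃Z x' → y ≃Z y' → (x *Z y) ≃Z (x' *Z y')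
*Z-cong (ez p) (ez q) = ez (λ k → Cong-* k (p k) (q k))

-- The quotient sequence c_k is read off at level k + N, where 2^N divides β.
Z2-exact-div : ∀ β N → Div N (seq β N) → Σ Z2 λ c → (c *Z pow2Z N) ≃Z β
Z2-exact-div β N dN = mkZ2 quot quot-coh , ≈Z⇒≃Z quot-spec
  where
  dk : ∀ k → Div N (seq β (k ℕ.+ N))
  dk k = Div-seq β N ℕP.≤-refl (ℕP.m≤n+m N k) dN
  quot : ℕ → ℤ
  quot k = proj₁ (dk k)
  factor : ∀ a b c d x → a ≡ c * x → b ≡ d * x → a - b ≡ (c - d) * x
  factor a b c d x refl refl = distrib c d x
    where
    distrib : ∀ c d x → c * x - d * x ≡ (c - d) * x
    distrib = solve-∀
  quot-coh : ∀ k → Div k (quot (suc k) - quot k)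
  quot-coh k = Div-*2^-cancel k N (subst (Div (k ℕ.+ N))
    (factor _ _ (quot (suc k)) (quot k) (2^ N) (proj₂ (dk (suc k))) (proj₂ (dk k))) (coh β (k ℕ.+ N)))
  quot-spec : ∀ k → Div k (quot k * 2^ N - seq β k)
  quot-spec k = subst (λ z → Div k (z - seq β k)) (proj₂ (dk k)) (div (seq-coherent β k (k ℕ.+ N) (ℕP.m≤m+n k N)))

*Z-assoc : ∀ x y z → ((x *Z y) *Z z) ≃Z (x *Z (y *Z z))
*Z-assoc x y z = ≃Z-pointwise λ k → ℤP.*-assoc (seq x k) (seq y k) (seq z k)

infix 4 _≃Q_
record _≃Q_ (p q : Q2) : Set where
  constructor by-cross
  field
    cross : ∀ k → Cong k (seq (num p) k * 2^ (ex q)) (seq (num q) k * 2^ (ex p))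
open _≃Q_ public

≈Q⇒≃Q : ∀ {p q} → p ≈Q q → p ≃Q q
≈Q⇒≃Q h = by-cross (λ k → by-div (h k))

≃Q⇒≈Q : ∀ {p q} → p ≃Q q → p ≈Q q
≃Q⇒≈Q (by-cross h) k = div (h k)

≃Q-exact : ∀ {p q} → (∀ k → seq (num p) k * 2^ (ex q) ≡ seq (num q) k * 2^ (ex p)) → p ≃Q q
≃Q-exact e = by-cross (λ k → Cong-reflexive k (e k))

≃Q-refl : ∀ p → p ≃Q p
≃Q-refl p = by-cross (λ k → Cong-refl k _)

≃Q-reflexive : ∀ {p q} → p ≡ q → p ≃Q q
≃Q-reflexive {p} refl = ≃Q-refl p

≃Q-sym : ∀ {p q} → p ≃Q q → q ≃Q p
≃Q-sym (by-cross h) = by-cross (λ k → Cong-sym k (h k))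

-- The middle denominator 2^(ex q) is cancelled at level k + ex q.
≃Q-trans : ∀ {p q r} → p ≃Q q → q ≃Q r → p ≃Q r
≃Q-trans {p} {q} {r} (by-cross h₁) (by-cross h₂) = by-cross λ k →
  Cong-trans k (Cong-sym k (lower p r k)) (Cong-trans k (Cong-*2^-cancel k (ex q) (middle (k ℕ.+ ex q))) (lower r p k))
  where
  lower : ∀ x y k → Cong k (seq (num x) (k ℕ.+ ex q) * 2^ (ex y)) (seq (num x) k * 2^ (ex y))
  lower x y k = Cong-* k (seq-coherent (num x) k (k ℕ.+ ex q) (ℕP.m≤m+n k (ex q))) (Cong-refl k (2^ (ex y)))
  middle : ∀ K → Cong K ((seq (num p) K * 2^ (ex r)) * 2^ (ex q)) ((seq (num r) K * 2^ (ex p)) * 2^ (ex q))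
  middle K = Cong-trans K (Cong-reflexive K (swap₁ (seq (num p) K) (2^ (ex q)) (2^ (ex r))))
               (Cong-trans K (Cong-* K (h₁ K) (Cong-refl K (2^ (ex r))))
               (Cong-trans K (Cong-reflexive K (swap₂ (seq (num q) K) (2^ (ex p)) (2^ (ex r))))
               (Cong-trans K (Cong-* K (h₂ K) (Cong-refl K (2^ (ex p))))
               (Cong-reflexive K (swap₃ (seq (num r) K) (2^ (ex p)) (2^ (ex q)))))))
    where
    swap₁ : ∀ a y z → (a * z) * y ≡ a * y * z
    swap₁ = solve-∀
    swap₂ : ∀ b x z → b * x * z ≡ b * z * x
    swap₂ = solve-∀
    swap₃ : ∀ c x y → c * y * x ≡ (c * x) * y
    swap₃ = solve-∀

≃Q-isEquivalence : IsEquivalence _≃Q_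
≃Q-isEquivalence = record
  { refl = λ {p} → ≃Q-refl p ; sym = ≃Q-sym ; trans = ≃Q-trans }

-- Opaque copies of the field operations, so that the ring solver compares
-- normal forms without unfolding the arithmetic on representatives.
infixl 6 _⊞_
infixl 7 _⊠_
opaque
  _⊞_ : Q2 → Q2 → Q2
  _⊞_ = _+Q_
  _⊠_ : Q2 → Q2 → Q2
  _⊠_ = _*Q_
  ⊟ : Q2 → Q2
  ⊟ = -Q_
  0q : Q2
  0q = 0Q
  1q : Q2
  1q = ι (fromℤ (+ 1))
  czq : ℤ → Q2
  czq z = ι (fromℤ z)

-- In the exact laws 2^ (ex p + ex q) is abstracted to a variable W and
-- replaced by 2^ ex p * 2^ ex q, since it does not normalise to a product.
opaque
  unfolding _⊞_ _⊠_ ⊟ 0q 1q czq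

  +Q≃⊞ : ∀ p q → (p +Q q) ≃Q (p ⊞ q)
  +Q≃⊞ p q = ≃Q-refl _
  *Q≃⊠ : ∀ p q → (p *Q q) ≃Q (p ⊠ q)
  *Q≃⊠ p q = ≃Q-refl _
  -Q≃⊟ : ∀ p → (-Q p) ≃Q ⊟ p
  -Q≃⊟ p = ≃Q-refl _
  0Q≃0q : 0Q ≃Q 0q
  0Q≃0q = ≃Q-refl _
  ι-fromℤ≡czq : ∀ c → ι (fromℤ c) ≡ czq c
  ι-fromℤ≡czq c = refl

  ⊞-comm : ∀ p q → (p ⊞ q) ≃Q (q ⊞ p)
  ⊞-comm p q = ≃Q-exact λ k → shape (seq (num p) k) (seq (num q) k) (2^ (ex p)) (2^ (ex q)) _ _
    (2^-+ (ex p) (ex q)) (2^-+ (ex q) (ex p))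
    where
    shape : ∀ x y A B Z W → Z ≡ A * B → W ≡ B * A → (x * B + y * A) * W ≡ (y * A + x * B) * Z
    shape x y A B _ _ refl refl = identity x y A B
      where
      identity : ∀ x y A B → (x * B + y * A) * (B * A) ≡ (y * A + x * B) * (A * B)
      identity = solve-∀

  ⊞-assoc : ∀ p q r → ((p ⊞ q) ⊞ r) ≃Q (p ⊞ (q ⊞ r))
  ⊞-assoc p q r = ≃Q-exact λ k → shape (seq (num p) k) (seq (num q) k) (seq (num r) k) (2^ (ex p)) (2^ (ex q)) (2^ (ex r)) _ _ _ _
    (2^-+ (ex p) (ex q)) (2^-+ (ex q) (ex r)) (2^-+ (ex p) (ex q ℕ.+ ex r)) (2^-+ (ex p ℕ.+ ex q) (ex r))
    where
    shape : ∀ x y z A B C W₁ W₂ W₃ W₄ → W₁ ≡ A * B → W₂ ≡ B * C → W₃ ≡ A * W₂ → W₄ ≡ W₁ * C →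
            ((x * B + y * A) * C + z * W₁) * W₃ ≡ (x * W₂ + (y * C + z * B) * A) * W₄
    shape x y z A B C _ _ _ _ refl refl refl refl = identity x y z A B C
      where
      identity : ∀ x y z A B C → ((x * B + y * A) * C + z * (A * B)) * (A * (B * C))
                                 ≡ (x * (B * C) + (y * C + z * B) * A) * ((A * B) * C)
      identity = solve-∀

  ⊞-identityˡ : ∀ p → (0q ⊞ p) ≃Q p
  ⊞-identityˡ p = ≃Q-exact λ k → identity (seq (num p) k) (2^ (ex p))
    where
    identity : ∀ x A → (+ 0 * A + x * + 1) * A ≡ x * A
    identity = solve-∀

  ⊞-identityʳ : ∀ p → (p ⊞ 0q) ≃Q p
  ⊞-identityʳ p = ≃Q-exact λ k → shape (seq (num p) k) (2^ (ex p)) _ (2^-+ (ex p) 0)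
    where
    shape : ∀ x A W → W ≡ A * + 1 → (x * + 1 + + 0 * A) * A ≡ x * W
    shape x A _ refl = identity x A
      where
      identity : ∀ x A → (x * + 1 + + 0 * A) * A ≡ x * (A * + 1)
      identity = solve-∀

  ⊠-assoc : ∀ p q r → ((p ⊠ q) ⊠ r) ≃Q (p ⊠ (q ⊠ r))
  ⊠-assoc p q r = ≃Q-exact λ k → shape (seq (num p) k) (seq (num q) k) (seq (num r) k) (2^ (ex p)) (2^ (ex q)) (2^ (ex r)) _ _ _ _
    (2^-+ (ex p) (ex q)) (2^-+ (ex q) (ex r)) (2^-+ (ex p) (ex q ℕ.+ ex r)) (2^-+ (ex p ℕ.+ ex q) (ex r))
    where
    shape : ∀ x y z A B C W₁ W₂ W₃ W₄ → W₁ ≡ A * B → W₂ ≡ B * C → W₃ ≡ A * W₂ → W₄ ≡ W₁ * C →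
            ((x * y) * z) * W₃ ≡ (x * (y * z)) * W₄
    shape x y z A B C _ _ _ _ refl refl refl refl = identity x y z A B C
      where
      identity : ∀ x y z A B C → ((x * y) * z) * (A * (B * C)) ≡ (x * (y * z)) * ((A * B) * C)
      identity = solve-∀

  ⊠-comm : ∀ p q → (p ⊠ q) ≃Q (q ⊠ p)
  ⊠-comm p q = ≃Q-exact λ k → shape (seq (num p) k) (seq (num q) k) (2^ (ex p)) (2^ (ex q)) _ _
    (2^-+ (ex p) (ex q)) (2^-+ (ex q) (ex p))
    where
    shape : ∀ x y A B Z W → Z ≡ A * B → W ≡ B * A → (x * y) * W ≡ (y * x) * Z
    shape x y A B _ _ refl refl = identity x y A B
      where
      identity : ∀ x y A B → (x * y) * (B * A) ≡ (y * x) * (A * B)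
      identity = solve-∀

  ⊠-identityˡ : ∀ p → (1q ⊠ p) ≃Q p
  ⊠-identityˡ p = ≃Q-exact λ k → identity (seq (num p) k) (2^ (ex p))
    where
    identity : ∀ x A → (+ 1 * x) * A ≡ x * A
    identity = solve-∀

  ⊠-identityʳ : ∀ p → (p ⊠ 1q) ≃Q p
  ⊠-identityʳ p = ≃Q-exact λ k → shape (seq (num p) k) (2^ (ex p)) _ (2^-+ (ex p) 0)
    where
    shape : ∀ x A W → W ≡ A * + 1 → (x * + 1) * A ≡ x * W
    shape x A _ refl = identity x A
      where
      identity : ∀ x A → (x * + 1) * A ≡ x * (A * + 1)
      identity = solve-∀

  ⊠-distribˡ : ∀ p q r → (p ⊠ (q ⊞ r)) ≃Q ((p ⊠ q) ⊞ (p ⊠ r))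
  ⊠-distribˡ p q r = ≃Q-exact λ k → shape (seq (num p) k) (seq (num q) k) (seq (num r) k) (2^ (ex p)) (2^ (ex q)) (2^ (ex r)) _ _ _ _ _
    (2^-+ (ex p) (ex q)) (2^-+ (ex p) (ex r)) (2^-+ (ex q) (ex r)) (2^-+ (ex p) (ex q ℕ.+ ex r)) (2^-+ (ex p ℕ.+ ex q) (ex p ℕ.+ ex r))
    where
    shape : ∀ x y z A B C W₁ W₂ W₃ W₄ W₅ → W₁ ≡ A * B → W₂ ≡ A * C → W₃ ≡ B * C → W₄ ≡ A * W₃ → W₅ ≡ W₁ * W₂ →
            (x * (y * C + z * B)) * W₅ ≡ ((x * y) * W₂ + (x * z) * W₁) * W₄
    shape x y z A B C _ _ _ _ _ refl refl refl refl refl = identity x y z A B C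
      where
      identity : ∀ x y z A B C → (x * (y * C + z * B)) * ((A * B) * (A * C))
                                 ≡ ((x * y) * (A * C) + (x * z) * (A * B)) * (A * (B * C))
      identity = solve-∀

  ⊠-zeroˡ : ∀ p → (0q ⊠ p) ≃Q 0q
  ⊠-zeroˡ p = ≃Q-exact λ k → identity (seq (num p) k) (2^ (ex p))
    where
    identity : ∀ x A → (+ 0 * x) * + 1 ≡ + 0 * A
    identity = solve-∀

  ⊠-zeroʳ : ∀ p → (p ⊠ 0q) ≃Q 0q
  ⊠-zeroʳ p = ≃Q-exact λ k → identity (seq (num p) k) (2^ (ex p ℕ.+ 0))
    where
    identity : ∀ x A → (x * + 0) * + 1 ≡ + 0 * A
    identity = solve-∀

  ⊟-⊠-distribˡ : ∀ p q → (⊟ p ⊠ q) ≃Q ⊟ (p ⊠ q)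
  ⊟-⊠-distribˡ p q = ≃Q-exact λ k → identity (seq (num p) k) (seq (num q) k) (2^ (ex p ℕ.+ ex q))
    where
    identity : ∀ x y W → ((- x) * y) * W ≡ (- (x * y)) * W
    identity = solve-∀

  ⊟-⊞-comm : ∀ p q → (⊟ p ⊞ ⊟ q) ≃Q ⊟ (p ⊞ q)
  ⊟-⊞-comm p q = ≃Q-exact λ k → identity (seq (num p) k) (seq (num q) k) (2^ (ex p)) (2^ (ex q)) (2^ (ex p ℕ.+ ex q))
    where
    identity : ∀ x y A B W → ((- x) * B + (- y) * A) * W ≡ (- (x * B + y * A)) * W
    identity = solve-∀

  ⊟-cong : ∀ {p p'} → p ≃Q p' → ⊟ p ≃Q ⊟ p'
  ⊟-cong {p} {p'} (by-cross h) = by-cross λ k →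
    Cong-resp-≡ k (identity (seq (num p) k) (2^ (ex p'))) (identity (seq (num p') k) (2^ (ex p))) (Cong-neg k (h k))
    where
    identity : ∀ x A → (- x) * A ≡ - (x * A)
    identity = solve-∀

  ⊞-cong : ∀ {p p' q q'} → p ≃Q p' → q ≃Q q' → (p ⊞ q) ≃Q (p' ⊞ q')
  ⊞-cong {p} {p'} {q} {q'} (by-cross h₁) (by-cross h₂) = by-cross λ k →
    Cong-resp-≡ k (shape (seq (num p) k) (seq (num q) k) (2^ (ex p)) (2^ (ex q)) (2^ (ex p')) (2^ (ex q')) _ (2^-+ (ex p') (ex q')))
                  (shape′ (seq (num p') k) (seq (num q') k) (2^ (ex p)) (2^ (ex q)) (2^ (ex p')) (2^ (ex q')) _ (2^-+ (ex p) (ex q)))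
      (Cong-+ k (Cong-* k (h₁ k) (Cong-refl k (2^ (ex q) * 2^ (ex q')))) (Cong-* k (h₂ k) (Cong-refl k (2^ (ex p) * 2^ (ex p')))))
    where
    shape : ∀ x y A B A' B' W → W ≡ A' * B' → (x * B + y * A) * W ≡ (x * A') * (B * B') + (y * B') * (A * A')
    shape x y A B A' B' _ refl = identity x y A B A' B'
      where
      identity : ∀ x y A B A' B' → (x * B + y * A) * (A' * B') ≡ (x * A') * (B * B') + (y * B') * (A * A')
      identity = solve-∀
    shape′ : ∀ x y A B A' B' W → W ≡ A * B → (x * B' + y * A') * W ≡ (x * A) * (B * B') + (y * B) * (A * A')
    shape′ x y A B A' B' _ refl = identity x y A B A' B'
      where
      identity : ∀ x y A B A' B' → (x * B' + y * A') * (A * B) ≡ (x * A) * (B * B') + (y * B) * (A * A')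
      identity = solve-∀

  ⊠-cong : ∀ {p p' q q'} → p ≃Q p' → q ≃Q q' → (p ⊠ q) ≃Q (p' ⊠ q')
  ⊠-cong {p} {p'} {q} {q'} (by-cross h₁) (by-cross h₂) = by-cross λ k →
    Cong-resp-≡ k (shape (seq (num p) k) (seq (num q) k) (2^ (ex p')) (2^ (ex q')) _ (2^-+ (ex p') (ex q')))
                  (shape (seq (num p') k) (seq (num q') k) (2^ (ex p)) (2^ (ex q)) _ (2^-+ (ex p) (ex q)))
      (Cong-* k (h₁ k) (h₂ k))
    where
    shape : ∀ x y A' B' W → W ≡ A' * B' → (x * y) * W ≡ (x * A') * (y * B')
    shape x y A' B' _ refl = identity x y A' B'
      where
      identity : ∀ x y A' B' → (x * y) * (A' * B') ≡ (x * A') * (y * B')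
      identity = solve-∀

  czq-+ : ∀ a b → czq (a + b) ≃Q (czq a ⊞ czq b)
  czq-+ a b = ≃Q-exact λ k → identity a b
    where
    identity : ∀ a b → (a + b) * + 1 ≡ (a * + 1 + b * + 1) * + 1
    identity = solve-∀
  czq-* : ∀ a b → czq (a * b) ≃Q (czq a ⊠ czq b)
  czq-* a b = ≃Q-exact λ k → refl
  czq-neg : ∀ a → czq (- a) ≃Q ⊟ (czq a)
  czq-neg a = ≃Q-exact λ k → refl
  czq-0 : czq (+ 0) ≃Q 0q
  czq-0 = ≃Q-exact λ k → refl
  czq-1 : czq (+ 1) ≃Q 1q
  czq-1 = ≃Q-exact λ k → refl

  ι-+ : ∀ x y → ι (x +Z y) ≃Q (ι x ⊞ ι y)
  ι-+ x y = ≃Q-exact λ k → identity (seq x k) (seq y k)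
    where
    identity : ∀ a b → (a + b) * + 1 ≡ (a * + 1 + b * + 1) * + 1
    identity = solve-∀

  ι-* : ∀ x y → ι (x *Z y) ≃Q (ι x ⊠ ι y)
  ι-* x y = ≃Q-exact λ k → refl

  ι-neg : ∀ x → ι (-Z x) ≃Q ⊟ (ι x)
  ι-neg x = ≃Q-exact λ k → refl

  2^ex⊠≃ι : ∀ q m → (czq (2^ (ex q ℕ.+ m)) ⊠ q) ≃Q ι (num q *Z pow2Z m)
  2^ex⊠≃ι q m = ≃Q-exact λ k → shape (seq (num q) k) (2^ (ex q)) (2^ m) _ (2^-+ (ex q) m)
    where
    shape : ∀ x A B W → W ≡ A * B → (W * x) * + 1 ≡ (x * B) * A
    shape x A B _ refl = identity x A B
      where
      identity : ∀ x A B → ((A * B) * x) * + 1 ≡ (x * B) * A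
      identity = solve-∀

  half^ : ℕ → Q2
  half^ n = mkQ2 (fromℤ (+ 1)) n

  half^-inverse : ∀ n → (half^ n ⊠ czq (2^ n)) ≃Q 1q
  half^-inverse n = ≃Q-exact λ k → shape (2^ n) _ (2^-+ n 0)
    where
    shape : ∀ A W → W ≡ A * + 1 → (+ 1 * A) * + 1 ≡ + 1 * W
    shape A _ refl = identity A
      where
      identity : ∀ A → (+ 1 * A) * + 1 ≡ + 1 * (A * + 1)
      identity = solve-∀

  2^⊠-cancel : ∀ M a b → (czq (2^ M) ⊠ a) ≃Q (czq (2^ M) ⊠ b) → a ≃Q b
  2^⊠-cancel M a b (by-cross h) = by-cross λ k →
    Cong-trans k (Cong-sym k (lower a b k)) (Cong-trans k (Cong-*2^-cancel k M (middle (k ℕ.+ M))) (lower b a k))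
    where
    lower : ∀ x y k → Cong k (seq (num x) (k ℕ.+ M) * 2^ (ex y)) (seq (num x) k * 2^ (ex y))
    lower x y k = Cong-* k (seq-coherent (num x) k (k ℕ.+ M) (ℕP.m≤m+n k M)) (Cong-refl k (2^ (ex y)))
    middle : ∀ K → Cong K ((seq (num a) K * 2^ (ex b)) * 2^ M) ((seq (num b) K * 2^ (ex a)) * 2^ M)
    middle K = Cong-resp-≡ K (identity (2^ M) (seq (num a) K) (2^ (ex b))) (identity (2^ M) (seq (num b) K) (2^ (ex a))) (h K)
      where
      identity : ∀ m x B → (x * B) * m ≡ (m * x) * B
      identity = solve-∀

⊠-distribʳ : ∀ p q r → ((q ⊞ r) ⊠ p) ≃Q ((q ⊠ p) ⊞ (r ⊠ p))
⊠-distribʳ p q r = ≃Q-trans (⊠-comm (q ⊞ r) p) (≃Q-trans (⊠-distribˡ p q r) (⊞-cong (⊠-comm p q) (⊠-comm p r)))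

Q2-isCommutativeSemiring : IsCommutativeSemiring _≃Q_ _⊞_ _⊠_ 0q 1q
Q2-isCommutativeSemiring = record
  { isSemiring = record
    { isSemiringWithoutAnnihilatingZero = record
      { +-isCommutativeMonoid = record
        { isMonoid = record
          { isSemigroup = record
            { isMagma = record { isEquivalence = ≃Q-isEquivalence ; ∙-cong = ⊞-cong }
            ; assoc = ⊞-assoc }
          ; identity = ⊞-identityˡ , ⊞-identityʳ }
        ; comm = ⊞-comm }
      ; *-cong = ⊠-cong
      ; *-assoc = ⊠-assoc
      ; *-identity = ⊠-identityˡ , ⊠-identityʳ
      ; distrib = ⊠-distribˡ , ⊠-distribʳ }
    ; zero = ⊠-zeroˡ , ⊠-zeroʳ }
  ; *-comm = ⊠-comm }

Q2-almostCommutativeRing : AlmostCommutativeRing _ _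
Q2-almostCommutativeRing = record
  { Carrier = Q2 ; _≈_ = _≃Q_ ; _+_ = _⊞_ ; _*_ = _⊠_ ; -_ = ⊟ ; 0# = 0q ; 1# = 1q
  ; isAlmostCommutativeRing = record
    { isCommutativeSemiring = Q2-isCommutativeSemiring
    ; -‿cong = ⊟-cong
    ; -‿*-distribˡ = ⊟-⊠-distribˡ
    ; -‿+-comm = ⊟-⊞-comm } }

ℤ⟶Q2 : ℤ.+-*-rawRing -Raw-AlmostCommutative⟶ Q2-almostCommutativeRing
ℤ⟶Q2 = record
  { ⟦_⟧ = czq ; +-homo = czq-+ ; *-homo = czq-* ; -‿homo = czq-neg ; 0-homo = czq-0 ; 1-homo = czq-1 }

czq-≟ : ∀ a b → Maybe (czq a ≃Q czq b)
czq-≟ a b with a ℤ.≟ b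
... | yes refl = just (≃Q-refl (czq a))
... | no _ = nothing

module Q2-Solver = RingSolver ℤ.+-*-rawRing Q2-almostCommutativeRing ℤ⟶Q2 czq-≟
open Q2-Solver using (solve; _:=_; _:+_; _:*_; _:-_; :-_; con)

ι-cong : ∀ {x y} → x ≃Z y → ι x ≃Q ι y
ι-cong (ez h) = by-cross λ k → Cong-* k (h k) (Cong-refl k (+ 1))

ι-injective : ∀ {x y} → ι x ≃Q ι y → x ≃Z y
ι-injective {x} {y} (by-cross h) = ez λ k →
  Cong-resp-≡ k (sym (ℤP.*-identityʳ (seq x k))) (sym (ℤP.*-identityʳ (seq y k))) (h k)

IsIntQ⇒≃ι : ∀ {q} → IsIntQ q → Σ Z2 λ c → q ≃Q ι c
IsIntQ⇒≃ι {q} (c , h) = c , by-cross λ k → Cong-resp-≡ k (ℤP.*-identityʳ (seq (num q) k)) refl (Cong-sym k (by-div (h k)))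

≃ι⇒IsIntQ : ∀ {q c} → q ≃Q ι c → IsIntQ q
≃ι⇒IsIntQ {q} {c} (by-cross h) = c , λ k → div (Cong-sym k (Cong-resp-≡ k (sym (ℤP.*-identityʳ (seq (num q) k))) refl (h k)))

-- Vectors in ℚ₂⁴

pattern i0 = zero
pattern i1 = suc zero
pattern i2 = suc (suc zero)
pattern i3 = suc (suc (suc zero))

infix 4 _≃V_
record _≃V_ (x y : V4) : Set where
  constructor by-coord
  field
    coord : ∀ i → x i ≃Q y i
open _≃V_ public

≈V⇒≃V : ∀ {x y} → x ≈V y → x ≃V y
≈V⇒≃V h = by-coord λ i → ≈Q⇒≃Q (h i)

≃V⇒≈V : ∀ {x y} → x ≃V y → x ≈V y
≃V⇒≈V (by-coord h) i = ≃Q⇒≈Q (h i)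

≃V-refl : ∀ x → x ≃V x
≃V-refl x = by-coord λ i → ≃Q-refl (x i)

≃V-sym : ∀ {x y} → x ≃V y → y ≃V x
≃V-sym (by-coord h) = by-coord λ i → ≃Q-sym (h i)

≃V-trans : ∀ {x y z} → x ≃V y → y ≃V z → x ≃V z
≃V-trans (by-coord h) (by-coord g) = by-coord λ i → ≃Q-trans (h i) (g i)

infixl 6 _⊕_
infixr 7 _⊙_
_⊕_ : V4 → V4 → V4
(x ⊕ y) i = x i ⊞ y i

_⊙_ : Q2 → V4 → V4
(a ⊙ x) i = a ⊠ x i

⊖ : V4 → V4
⊖ x i = ⊟ (x i)

ιV : (Fin 4 → Z2) → V4
ιV E i = ι (E i)

⊕-cong : ∀ {x x' y y'} → x ≃V x' → y ≃V y' → (x ⊕ y) ≃V (x' ⊕ y')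
⊕-cong (by-coord h) (by-coord g) = by-coord λ i → ⊞-cong (h i) (g i)

⊙-cong : ∀ {a a' x x'} → a ≃Q a' → x ≃V x' → (a ⊙ x) ≃V (a' ⊙ x')
⊙-cong h (by-coord g) = by-coord λ i → ⊠-cong h (g i)

⊖-cong : ∀ {x x'} → x ≃V x' → ⊖ x ≃V ⊖ x'
⊖-cong (by-coord h) = by-coord λ i → ⊟-cong (h i)

+V≃⊕ : ∀ x y → (x +V y) ≃V (x ⊕ y)
+V≃⊕ x y = by-coord λ i →
  ≃Q-trans (≃Q-exact {(x +V y) i} {x i +Q y i} λ k → refl) (+Q≃⊞ (x i) (y i))

·V+V≃⊙⊕ : ∀ a x b y → ((a ·V x) +V (b ·V y)) ≃V ((a ⊙ x) ⊕ (b ⊙ y))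
·V+V≃⊙⊕ a x b y = by-coord λ i →
  ≃Q-trans (≃Q-exact {((a ·V x) +V (b ·V y)) i} {(a *Q x i) +Q (b *Q y i)} λ k → refl)
    (≃Q-trans (+Q≃⊞ (a *Q x i) (b *Q y i)) (⊞-cong (*Q≃⊠ a (x i)) (*Q≃⊠ b (y i))))

-V≃⊕⊖ : ∀ x y → (x -V y) ≃V (x ⊕ ⊖ y)
-V≃⊕⊖ x y = by-coord λ i →
  ≃Q-trans (≃Q-exact {(x -V y) i} {x i +Q (-Q y i)} λ k → refl)
    (≃Q-trans (+Q≃⊞ (x i) (-Q y i)) (⊞-cong (≃Q-refl (x i)) (-Q≃⊟ (y i))))

0V≃ : 0V ≃V (λ _ → 0q)
0V≃ = by-coord λ i → 0Q≃0q

dot : V4 → V4 → Q2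
dot x y = (x i0 ⊠ y i0) ⊞ ((x i1 ⊠ y i1) ⊞ ((x i2 ⊠ y i2) ⊞ (x i3 ⊠ y i3)))

⟨⟩≃dot : ∀ x y → ⟨ x , y ⟩ ≃Q dot x y
⟨⟩≃dot x y =
  ≃Q-trans (+Q≃⊞ (x i0 *Q y i0) ((x i1 *Q y i1) +Q ((x i2 *Q y i2) +Q (x i3 *Q y i3)))) (⊞-cong (*Q≃⊠ (x i0) (y i0)) (
  ≃Q-trans (+Q≃⊞ (x i1 *Q y i1) ((x i2 *Q y i2) +Q (x i3 *Q y i3))) (⊞-cong (*Q≃⊠ (x i1) (y i1)) (
  ≃Q-trans (+Q≃⊞ (x i2 *Q y i2) (x i3 *Q y i3)) (⊞-cong (*Q≃⊠ (x i2) (y i2)) (*Q≃⊠ (x i3) (y i3)))))))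

dot-cong : ∀ {x x' y y'} → x ≃V x' → y ≃V y' → dot x y ≃Q dot x' y'
dot-cong (by-coord h) (by-coord g) =
  ⊞-cong (⊠-cong (h i0) (g i0)) (⊞-cong (⊠-cong (h i1) (g i1)) (⊞-cong (⊠-cong (h i2) (g i2)) (⊠-cong (h i3) (g i3))))

dot-comm : ∀ x y → dot x y ≃Q dot y x
dot-comm x y = comm (x i0) (x i1) (x i2) (x i3) (y i0) (y i1) (y i2) (y i3)
  where
  comm : ∀ x0 x1 x2 x3 y0 y1 y2 y3 →
    ((x0 ⊠ y0) ⊞ ((x1 ⊠ y1) ⊞ ((x2 ⊠ y2) ⊞ (x3 ⊠ y3)))) ≃Q ((y0 ⊠ x0) ⊞ ((y1 ⊠ x1) ⊞ ((y2 ⊠ x2) ⊞ (y3 ⊠ x3))))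
  comm = solve 8 (λ x0 x1 x2 x3 y0 y1 y2 y3 →
    ((x0 :* y0) :+ ((x1 :* y1) :+ ((x2 :* y2) :+ (x3 :* y3)))) := ((y0 :* x0) :+ ((y1 :* x1) :+ ((y2 :* x2) :+ (y3 :* x3))))) (≃Q-refl _)

dot-⊕ˡ : ∀ x y z → dot (x ⊕ y) z ≃Q (dot x z ⊞ dot y z)
dot-⊕ˡ x y z = additive (x i0) (x i1) (x i2) (x i3) (y i0) (y i1) (y i2) (y i3) (z i0) (z i1) (z i2) (z i3)
  where
  additive : ∀ x0 x1 x2 x3 y0 y1 y2 y3 z0 z1 z2 z3 →
    (((x0 ⊞ y0) ⊠ z0) ⊞ (((x1 ⊞ y1) ⊠ z1) ⊞ (((x2 ⊞ y2) ⊠ z2) ⊞ ((x3 ⊞ y3) ⊠ z3))))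
    ≃Q (((x0 ⊠ z0) ⊞ ((x1 ⊠ z1) ⊞ ((x2 ⊠ z2) ⊞ (x3 ⊠ z3)))) ⊞ ((y0 ⊠ z0) ⊞ ((y1 ⊠ z1) ⊞ ((y2 ⊠ z2) ⊞ (y3 ⊠ z3)))))
  additive = solve 12 (λ x0 x1 x2 x3 y0 y1 y2 y3 z0 z1 z2 z3 →
    (((x0 :+ y0) :* z0) :+ (((x1 :+ y1) :* z1) :+ (((x2 :+ y2) :* z2) :+ ((x3 :+ y3) :* z3))))
    := (((x0 :* z0) :+ ((x1 :* z1) :+ ((x2 :* z2) :+ (x3 :* z3)))) :+ ((y0 :* z0) :+ ((y1 :* z1) :+ ((y2 :* z2) :+ (y3 :* z3)))))) (≃Q-refl _)

dot-⊙ˡ : ∀ a x z → dot (a ⊙ x) z ≃Q (a ⊠ dot x z)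
dot-⊙ˡ a x z = homogeneous a (x i0) (x i1) (x i2) (x i3) (z i0) (z i1) (z i2) (z i3)
  where
  homogeneous : ∀ a x0 x1 x2 x3 z0 z1 z2 z3 →
    (((a ⊠ x0) ⊠ z0) ⊞ (((a ⊠ x1) ⊠ z1) ⊞ (((a ⊠ x2) ⊠ z2) ⊞ ((a ⊠ x3) ⊠ z3))))
    ≃Q (a ⊠ ((x0 ⊠ z0) ⊞ ((x1 ⊠ z1) ⊞ ((x2 ⊠ z2) ⊞ (x3 ⊠ z3)))))
  homogeneous = solve 9 (λ a x0 x1 x2 x3 z0 z1 z2 z3 →
    (((a :* x0) :* z0) :+ (((a :* x1) :* z1) :+ (((a :* x2) :* z2) :+ ((a :* x3) :* z3))))
    := (a :* ((x0 :* z0) :+ ((x1 :* z1) :+ ((x2 :* z2) :+ (x3 :* z3)))))) (≃Q-refl _)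

dot-⊖ˡ : ∀ x z → dot (⊖ x) z ≃Q ⊟ (dot x z)
dot-⊖ˡ x z = negation (x i0) (x i1) (x i2) (x i3) (z i0) (z i1) (z i2) (z i3)
  where
  negation : ∀ x0 x1 x2 x3 z0 z1 z2 z3 →
    ((⊟ x0 ⊠ z0) ⊞ ((⊟ x1 ⊠ z1) ⊞ ((⊟ x2 ⊠ z2) ⊞ (⊟ x3 ⊠ z3))))
    ≃Q ⊟ ((x0 ⊠ z0) ⊞ ((x1 ⊠ z1) ⊞ ((x2 ⊠ z2) ⊞ (x3 ⊠ z3))))
  negation = solve 8 (λ x0 x1 x2 x3 z0 z1 z2 z3 →
    (((:- x0) :* z0) :+ (((:- x1) :* z1) :+ (((:- x2) :* z2) :+ ((:- x3) :* z3))))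
    := (:- ((x0 :* z0) :+ ((x1 :* z1) :+ ((x2 :* z2) :+ (x3 :* z3)))))) (≃Q-refl _)

dot-linearˡ : ∀ a x b y z → dot ((a ⊙ x) ⊕ (b ⊙ y)) z ≃Q ((a ⊠ dot x z) ⊞ (b ⊠ dot y z))
dot-linearˡ a x b y z = ≃Q-trans (dot-⊕ˡ (a ⊙ x) (b ⊙ y) z) (⊞-cong (dot-⊙ˡ a x z) (dot-⊙ˡ b y z))

dot-linearʳ : ∀ z a x b y → dot z ((a ⊙ x) ⊕ (b ⊙ y)) ≃Q ((a ⊠ dot z x) ⊞ (b ⊠ dot z y))
dot-linearʳ z a x b y = ≃Q-trans (dot-comm z ((a ⊙ x) ⊕ (b ⊙ y))) (≃Q-trans (dot-linearˡ a x b y z)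
  (⊞-cong (⊠-cong (≃Q-refl a) (dot-comm x z)) (⊠-cong (≃Q-refl b) (dot-comm y z))))

dotZ : (Fin 4 → Z2) → (Fin 4 → Z2) → Z2
dotZ E F = (E i0 *Z F i0) +Z ((E i1 *Z F i1) +Z ((E i2 *Z F i2) +Z (E i3 *Z F i3)))

dot-ιV : ∀ E F → dot (ιV E) (ιV F) ≃Q ι (dotZ E F)
dot-ιV E F = ≃Q-sym (
  ≃Q-trans (ι-+ (E i0 *Z F i0) ((E i1 *Z F i1) +Z ((E i2 *Z F i2) +Z (E i3 *Z F i3)))) (⊞-cong (ι-* (E i0) (F i0)) (
  ≃Q-trans (ι-+ (E i1 *Z F i1) ((E i2 *Z F i2) +Z (E i3 *Z F i3))) (⊞-cong (ι-* (E i1) (F i1)) (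
  ≃Q-trans (ι-+ (E i2 *Z F i2) (E i3 *Z F i3)) (⊞-cong (ι-* (E i2) (F i2)) (ι-* (E i3) (F i3))))))))

-- The lattice L(ℤ₂) and its dual

InL≃ : V4 → V4 → V4 → Set
InL≃ u v w = Σ Q2 λ a → Σ Q2 λ b → w ≃V ((a ⊙ u) ⊕ (b ⊙ v))

InL⇒InL≃ : ∀ {u v w} → InL u v w → InL≃ u v w
InL⇒InL≃ {u} {v} {w} (a , b , h) = a , b , ≃V-trans (≈V⇒≃V {w} {(a ·V u) +V (b ·V v)} h) (·V+V≃⊙⊕ a u b v)

InL≃⇒InL : ∀ {u v w} → InL≃ u v w → InL u v w
InL≃⇒InL {u} {v} {w} (a , b , h) = a , b , ≃V⇒≈V {w} {(a ·V u) +V (b ·V v)} (≃V-trans h (≃V-sym (·V+V≃⊙⊕ a u b v)))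

InL≃-resp : ∀ {u v x y} → x ≃V y → InL≃ u v y → InL≃ u v x
InL≃-resp x≃y (a , b , h) = a , b , ≃V-trans x≃y h

InL≃-⊕ : ∀ {u v x y} → InL≃ u v x → InL≃ u v y → InL≃ u v (x ⊕ y)
InL≃-⊕ {u} {v} (a , b , hx) (c , d , hy) = a ⊞ c , b ⊞ d ,
  ≃V-trans (⊕-cong hx hy) (by-coord λ i → collect a b c d (u i) (v i))
  where
  collect : ∀ a b c d U V → (((a ⊠ U) ⊞ (b ⊠ V)) ⊞ ((c ⊠ U) ⊞ (d ⊠ V))) ≃Q (((a ⊞ c) ⊠ U) ⊞ ((b ⊞ d) ⊠ V))
  collect = solve 6 (λ a b c d U V → (((a :* U) :+ (b :* V)) :+ ((c :* U) :+ (d :* V))) := (((a :+ c) :* U) :+ ((b :+ d) :* V))) (≃Q-refl _)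

InL≃-⊙ : ∀ {u v x} r → InL≃ u v x → InL≃ u v (r ⊙ x)
InL≃-⊙ {u} {v} r (a , b , hx) = r ⊠ a , r ⊠ b ,
  ≃V-trans (⊙-cong (≃Q-refl r) hx) (by-coord λ i → distribute r a b (u i) (v i))
  where
  distribute : ∀ r a b U V → (r ⊠ ((a ⊠ U) ⊞ (b ⊠ V))) ≃Q (((r ⊠ a) ⊠ U) ⊞ ((r ⊠ b) ⊠ V))
  distribute = solve 5 (λ r a b U V → (r :* ((a :* U) :+ (b :* V))) := (((r :* a) :* U) :+ ((r :* b) :* V))) (≃Q-refl _)

InL≃-⊖ : ∀ {u v x} → InL≃ u v x → InL≃ u v (⊖ x)
InL≃-⊖ {u} {v} (a , b , hx) = ⊟ a , ⊟ b , ≃V-trans (⊖-cong hx) (by-coord λ i → negate a b (u i) (v i))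
  where
  negate : ∀ a b U V → ⊟ ((a ⊠ U) ⊞ (b ⊠ V)) ≃Q ((⊟ a ⊠ U) ⊞ (⊟ b ⊠ V))
  negate = solve 4 (λ a b U V → (:- ((a :* U) :+ (b :* V))) := (((:- a) :* U) :+ ((:- b) :* V))) (≃Q-refl _)

IntegralV⇒≃ιV : ∀ w → IntegralV w → Σ (Fin 4 → Z2) λ W → w ≃V ιV W
IntegralV⇒≃ιV w w-int = (λ i → proj₁ (IsIntQ⇒≃ι {w i} (w-int i))) , by-coord λ i → proj₂ (IsIntQ⇒≃ι {w i} (w-int i))

≃ιV⇒IntegralV : ∀ {w W} → w ≃V ιV W → IntegralV w
≃ιV⇒IntegralV (by-coord h) i = ≃ι⇒IsIntQ (h i)

ι-linear : ∀ α a β b → ((ι α ⊠ ι a) ⊞ (ι β ⊠ ι b)) ≃Q ι ((α *Z a) +Z (β *Z b))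
ι-linear α a β b = ≃Q-sym (≃Q-trans (ι-+ (α *Z a) (β *Z b)) (⊞-cong (ι-* α a) (ι-* β b)))

ι-2* : ∀ x → ι (x *Z pow2Z 1) ≃Q (czq (+ 2) ⊠ ι x)
ι-2* x = ≃Q-trans (ι-* x (pow2Z 1)) (≃Q-trans (⊠-cong (≃Q-refl (ι x)) (≃Q-reflexive (ι-fromℤ≡czq (+ 2))))
  (⊠-comm (ι x) (czq (+ 2))))

half^⊠2^ : ∀ n x → (half^ n ⊠ (czq (2^ n) ⊠ x)) ≃Q x
half^⊠2^ n x = ≃Q-trans (≃Q-sym (⊠-assoc (half^ n) (czq (2^ n)) x))
  (≃Q-trans (⊠-cong (half^-inverse n) (≃Q-refl x)) (⊠-identityˡ x))

half^⊠ι2^ : ∀ n y → (half^ n ⊠ ι (pow2Z n *Z y)) ≃Q ι y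
half^⊠ι2^ n y = ≃Q-trans (⊠-cong (≃Q-refl (half^ n))
  (≃Q-trans (ι-* (pow2Z n) y) (⊠-cong (≃Q-reflexive (ι-fromℤ≡czq (2^ n))) (≃Q-refl (ι y))))) (half^⊠2^ n (ι y))

Z2-halve : (G : Fin 4 → Z2) → (∀ i → Div 1 (seq (G i) 1)) → Σ (Fin 4 → Z2) λ H → ∀ i → ιV G i ≃Q (czq (+ 2) ⊠ ιV H i)
Z2-halve G G-even = (λ i → proj₁ (half i)) , λ i →
  ≃Q-trans (ι-cong (≃Z-sym (proj₂ (half i)))) (ι-2* (proj₁ (half i)))
  where
  half : ∀ i → Σ Z2 λ c → (c *Z pow2Z 1) ≃Z G i
  half i = Z2-exact-div (G i) 1 (G-even i)

clear-denominators : ∀ w → Σ ℕ λ N → Σ (Fin 4 → Z2) λ W → (czq (2^ N) ⊙ w) ≃V ιV W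
clear-denominators w = N , W , by-coord λ i →
  subst (λ K → (czq (2^ K) ⊠ w i) ≃Q ι (W i)) (sym (split i)) (2^ex⊠≃ι (w i) (rest i))
  where
  d : Fin 4 → ℕ
  d i = ex (w i)
  N : ℕ
  N = d i0 ℕ.+ (d i1 ℕ.+ (d i2 ℕ.+ d i3))
  rest : Fin 4 → ℕ
  rest i0 = d i1 ℕ.+ (d i2 ℕ.+ d i3)
  rest i1 = d i0 ℕ.+ (d i2 ℕ.+ d i3)
  rest i2 = d i0 ℕ.+ (d i1 ℕ.+ d i3)
  rest i3 = d i0 ℕ.+ (d i1 ℕ.+ d i2)
  split : ∀ i → N ≡ d i ℕ.+ rest i
  split i0 = refl
  split i1 = shuffle (d i0) (d i1) (d i2) (d i3)
    where
    shuffle : ∀ a b c e → a ℕ.+ (b ℕ.+ (c ℕ.+ e)) ≡ b ℕ.+ (a ℕ.+ (c ℕ.+ e))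
    shuffle = ℕ-solve-∀
  split i2 = shuffle (d i0) (d i1) (d i2) (d i3)
    where
    shuffle : ∀ a b c e → a ℕ.+ (b ℕ.+ (c ℕ.+ e)) ≡ c ℕ.+ (a ℕ.+ (b ℕ.+ e))
    shuffle = ℕ-solve-∀
  split i3 = shuffle (d i0) (d i1) (d i2) (d i3)
    where
    shuffle : ∀ a b c e → a ℕ.+ (b ℕ.+ (c ℕ.+ e)) ≡ e ℕ.+ (a ℕ.+ (b ℕ.+ c))
    shuffle = ℕ-solve-∀
  W : Fin 4 → Z2
  W i = num (w i) *Z pow2Z (rest i)

-- Linear forms (ℓ₁, ℓ₂) on ℤ² read mod (2, 2^m) that induce an isomorphism
-- ℤ² / G ℤ² ≅ ℤ/2 × ℤ/2^m for the Gram matrix G = [[A, B], [B, C]] of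
-- determinant 2ⁿ·unit; (P, Q) lies in G ℤ² iff the adjugate sends it into 2ⁿ ℤ².
record GlueForms (n m : ℕ) (A B C : ℤ) : Set where
  field
    k₁ k₂ k₃ k₄ : ℤ
  ℓ₁ : ℤ → ℤ → ℤ
  ℓ₁ P Q = k₁ * P + k₂ * Q
  ℓ₂ : ℤ → ℤ → ℤ
  ℓ₂ P Q = k₃ * P + k₄ * Q
  field
    kills-image : ∀ α β → Div 1 (ℓ₁ (A * α + B * β) (B * α + C * β)) × Div m (ℓ₂ (A * α + B * β) (B * α + C * β))
    kernel⊆image : ∀ P Q → Div 1 (ℓ₁ P Q) → Div m (ℓ₂ P Q) → Div n (A * Q - B * P) × Div n (C * P - B * Q)
    onto : ∀ t₁ t₂ → Σ ℤ λ P → Σ ℤ λ Q → Cong 1 (ℓ₁ P Q) t₁ × Cong m (ℓ₂ P Q) t₂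

GlueForms-swap : ∀ {n m A B C} → GlueForms n m A B C → GlueForms n m C B A
GlueForms-swap {n} {m} {A} {B} {C} forms = record
  { k₁ = k₂ ; k₂ = k₁ ; k₃ = k₄ ; k₄ = k₃
  ; kills-image = λ α β → let (d₁ , d₂) = kills-image β α in
      subst (Div 1) (swap-image k₁ k₂ A B C α β) d₁ , subst (Div m) (swap-image k₃ k₄ A B C α β) d₂
  ; kernel⊆image = λ P Q d₁ d₂ → let (dA , dC) = kernel⊆image Q P (subst (Div 1) (swap k₂ k₁ P Q) d₁)
                                                                (subst (Div m) (swap k₄ k₃ P Q) d₂) in dC , dA
  ; onto = λ t₁ t₂ → let (P , Q , c₁ , c₂) = onto t₁ t₂ in
      Q , P , Cong-resp-≡ 1 (swap k₂ k₁ Q P) refl c₁ , Cong-resp-≡ m (swap k₄ k₃ Q P) refl c₂ }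
  where
  open GlueForms forms
  swap : ∀ k k′ P Q → k * P + k′ * Q ≡ k′ * Q + k * P
  swap k k′ P Q = ℤP.+-comm (k * P) (k′ * Q)
  swap-image : ∀ k k′ A B C α β → k * (A * β + B * α) + k′ * (B * β + C * α) ≡ k′ * (C * α + B * β) + k * (B * α + A * β)
  swap-image = solve-∀

forms-1 : ∀ A B C → Div 1 (A * C - B * B) → Odd A → GlueForms 1 0 A B C
forms-1 A B C 2∣Δ A-odd = record
  { k₁ = - B ; k₂ = A ; k₃ = + 0 ; k₄ = + 0
  ; kills-image = λ α β → subst (Div 1) (sym (image α β)) (Div-*ʳ 1 β 2∣Δ) , Div-2^0 _
  ; kernel⊆image = λ P Q d₁ _ → subst (Div 1) (form P Q) d₁ ,
      Div-cancel-odd 1 (odd⇒¬even A-odd) (subst (Div 1) (adjugate P Q) (Div-+ 1 (Div-*ʳ 1 P 2∣Δ) (Div-*ˡ 1 (- B) d₁)))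
  ; onto = λ t₁ t₂ → + 0 , t₁ , Cong-trans 1 (Cong-reflexive 1 (drop A B t₁)) (odd-*-Cong t₁ A-odd) , by-div (Div-2^0 _) }
  where
  image : ∀ α β → - B * (A * α + B * β) + A * (B * α + C * β) ≡ (A * C - B * B) * β
  image α β = identity A B C α β
    where
    identity : ∀ A B C α β → - B * (A * α + B * β) + A * (B * α + C * β) ≡ (A * C - B * B) * β
    identity = solve-∀
  form : ∀ P Q → - B * P + A * Q ≡ A * Q - B * P
  form P Q = identity A B P Q
    where
    identity : ∀ A B P Q → - B * P + A * Q ≡ A * Q - B * P
    identity = solve-∀
  adjugate : ∀ P Q → (A * C - B * B) * P + - B * (- B * P + A * Q) ≡ A * (C * P - B * Q)
  adjugate P Q = identity A B C P Q
    where
    identity : ∀ A B C P Q → (A * C - B * B) * P + - B * (- B * P + A * Q) ≡ A * (C * P - B * Q)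
    identity = solve-∀
  drop : ∀ A B t → - B * + 0 + A * t ≡ A * t
  drop = solve-∀

forms-2 : ∀ a b c → GlueForms 2 1 (a * + 2) (b * + 2) (c * + 2)
forms-2 a b c = record
  { k₁ = + 1 ; k₂ = + 0 ; k₃ = + 0 ; k₄ = + 1
  ; kills-image = λ α β → (a * α + b * β , first a b c α β) , (b * α + c * β , second a b c α β)
  ; kernel⊆image = λ P Q d₁ d₂ → both-even P Q (subst (Div 1) (first-form P Q) d₁) (subst (Div 1) (second-form P Q) d₂)
  ; onto = λ t₁ t₂ → t₁ , t₂ , Cong-reflexive 1 (first-form t₁ t₂) , Cong-reflexive 1 (second-form t₁ t₂) }
  where
  first : ∀ a b c α β → + 1 * (a * + 2 * α + b * + 2 * β) + + 0 * (b * + 2 * α + c * + 2 * β) ≡ (a * α + b * β) * + 2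
  first = solve-∀
  second : ∀ a b c α β → + 0 * (a * + 2 * α + b * + 2 * β) + + 1 * (b * + 2 * α + c * + 2 * β) ≡ (b * α + c * β) * + 2
  second = solve-∀
  first-form : ∀ P Q → + 1 * P + + 0 * Q ≡ P
  first-form = solve-∀
  second-form : ∀ P Q → + 0 * P + + 1 * Q ≡ Q
  second-form = solve-∀
  both-even : ∀ P Q → Div 1 P → Div 1 Q → Div 2 (a * + 2 * Q - b * + 2 * P) × Div 2 (c * + 2 * P - b * + 2 * Q)
  both-even .(P′ * + 2) .(Q′ * + 2) (P′ , refl) (Q′ , refl) = (a * Q′ - b * P′ , expand a b P′ Q′) , (c * P′ - b * Q′ , expand c b Q′ P′)
    where
    expand : ∀ a b P′ Q′ → a * + 2 * (Q′ * + 2) - b * + 2 * (P′ * + 2) ≡ (a * Q′ - b * P′) * + 4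
    expand = solve-∀

-- ℓ₂ = a Q - b P is taken mod 4; surjectivity uses that odd squares are 1 mod 4.
forms-3 : ∀ a b c → Div 1 (a * c - b * b) → Odd a → GlueForms 3 2 (a * + 2) (b * + 2) (c * + 2)
forms-3 a b c 2∣δ a-odd = record
  { k₁ = + 1 ; k₂ = + 0 ; k₃ = - b ; k₄ = a
  ; kills-image = λ α β → (a * α + b * β , first a b c α β) ,
      subst (Div 2) (sym (second a b c α β)) (Div-* 1 1 (Div-*ʳ 1 β 2∣δ) (Div-2^ 1))
  ; kernel⊆image = λ P Q d₁ d₂ → adjugate-divisible P Q (subst (Div 1) (first-form P Q) d₁) d₂
  ; onto = λ t₁ t₂ → t₁ , a * (t₂ + b * t₁) , Cong-reflexive 1 (first-form t₁ (a * (t₂ + b * t₁))) ,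
      by-div (subst (Div 2) (sym (lift a b t₁ t₂)) (Div-*ʳ 2 (t₂ + b * t₁) (odd-square (odd⇒¬even a-odd)))) }
  where
  first : ∀ a b c α β → + 1 * (a * + 2 * α + b * + 2 * β) + + 0 * (b * + 2 * α + c * + 2 * β) ≡ (a * α + b * β) * + 2
  first = solve-∀
  second : ∀ a b c α β → - b * (a * + 2 * α + b * + 2 * β) + a * (b * + 2 * α + c * + 2 * β) ≡ ((a * c - b * b) * β) * + 2
  second = solve-∀
  first-form : ∀ P Q → + 1 * P + + 0 * Q ≡ P
  first-form = solve-∀
  lift : ∀ a b t₁ t₂ → (- b * t₁ + a * (a * (t₂ + b * t₁))) - t₂ ≡ (a * a - + 1) * (t₂ + b * t₁)
  lift = solve-∀
  adjugate-divisible : ∀ P Q → Div 1 P → Div 2 (- b * P + a * Q) →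
                       Div 3 (a * + 2 * Q - b * + 2 * P) × Div 3 (c * + 2 * P - b * + 2 * Q)
  adjugate-divisible .(P′ * + 2) Q (P′ , refl) d₂ =
      subst (Div 3) (sym (rowA a b P′ Q)) (Div-* 2 1 d₂ (Div-2^ 1))
    , Div-cancel-odd 3 (odd⇒¬even a-odd) (subst (Div 3) (sym (rowC a b c P′ Q))
        (Div-minus 3 (Div-* 1 2 (Div-*ʳ 1 P′ 2∣δ) (Div-2^ 2)) (Div-* 2 1 (Div-*ˡ 2 b d₂) (Div-2^ 1))))
    where
    rowA : ∀ a b P′ Q → a * + 2 * Q - b * + 2 * (P′ * + 2) ≡ (- b * (P′ * + 2) + a * Q) * + 2
    rowA = solve-∀
    rowC : ∀ a b c P′ Q → a * (c * + 2 * (P′ * + 2) - b * + 2 * Q) ≡ ((a * c - b * b) * P′) * + 4 - (b * (- b * (P′ * + 2) + a * Q)) * + 2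
    rowC = solve-∀

even-square⇒even : ∀ {b} → Div 1 (b * b) → Div 1 b
even-square⇒even {b} 2∣b² =
  [ (λ even → even) , (λ odd → ⊥-elim (odd-* (odd⇒¬even odd) (odd⇒¬even odd) 2∣b²)) ]′ (parity b)

even-entries⇒4∣det : ∀ {A B C} → Div 1 A → Div 1 B → Div 1 C → Div 2 (A * C - B * B)
even-entries⇒4∣det (a , refl) (b , refl) (c , refl) = a * c - b * b , expand a b c
  where
  expand : ∀ a b c → a * + 2 * (c * + 2) - b * + 2 * (b * + 2) ≡ (a * c - b * b) * + 4
  expand = solve-∀

even-diagonal⇒even : ∀ A B C → Div 1 A → Div 1 (A * C - B * B) → Div 1 B
even-diagonal⇒even A B C 2∣A 2∣Δ =
  even-square⇒even (subst (Div 1) (cancel A B C) (Div-minus 1 (Div-*ʳ 1 C 2∣A) 2∣Δ))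
  where
  cancel : ∀ A B C → A * C - (A * C - B * B) ≡ B * B
  cancel = solve-∀

-- A Gram matrix whose determinant is 2·odd has an odd diagonal entry, and by symmetry it may be taken to be A.
forms-from-odd-entry : ∀ {n m} (s : ℤ → ℤ) →
  (∀ A B C → Div 1 (A * C - B * B) → Odd A → GlueForms n m (s A) (s B) (s C)) →
  ∀ A B C → Div 1 (A * C - B * B) → ¬ Div 2 (A * C - B * B) → GlueForms n m (s A) (s B) (s C)
forms-from-odd-entry s forms A B C 2∣Δ ¬4∣Δ with parity A | parity C
... | inj₂ A-odd | _ = forms A B C 2∣Δ A-odd
... | inj₁ _ | inj₂ C-odd = GlueForms-swap (forms C B A (subst (Div 1) (cong (_- B * B) (ℤP.*-comm A C)) 2∣Δ) C-odd)
... | inj₁ 2∣A | inj₁ 2∣C = ⊥-elim (¬4∣Δ (even-entries⇒4∣det 2∣A (even-diagonal⇒even A B C 2∣A 2∣Δ) 2∣C))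

forms-n1 : ∀ A B C → Div 1 (A * C - B * B) → ¬ Div 2 (A * C - B * B) → GlueForms 1 0 A B C
forms-n1 = forms-from-odd-entry (λ z → z) forms-1

forms-n2 : ∀ {A B C} → Div 1 A → Div 1 B → Div 1 C → GlueForms 2 1 A B C
forms-n2 (a , refl) (b , refl) (c , refl) = forms-2 a b c

forms-n3 : ∀ {A B C} → Div 1 A → Div 1 B → Div 1 C →
           Div 3 (A * C - B * B) → ¬ Div 4 (A * C - B * B) → GlueForms 3 2 A B C
forms-n3 (a , refl) (b , refl) (c , refl) 8∣Δ ¬16∣Δ = forms-from-odd-entry (_* + 2) forms-3 a b c
  (Div-2^*-cancel 1 2 (subst (Div 3) (factor a b c) 8∣Δ))
  (λ 4∣δ → ¬16∣Δ (subst (Div 4) (sym (factor a b c)) (Div-* 2 2 (Div-2^ 2) 4∣δ)))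
  where
  factor : ∀ a b c → a * + 2 * (c * + 2) - b * + 2 * (b * + 2) ≡ + 4 * (a * c - b * b)
  factor = solve-∀

-- Cramer's rule: Δ·α ≡ 2^N (C p - B q) and Δ·β ≡ 2^N (A q - B p) mod 2^(n+N).
cramer-divisible : ∀ n N {A B C d α β p q} → ¬ Div 1 d →
  Cong (n ℕ.+ N) (A * C + - (B * B)) (2^ n * d) →
  Cong (n ℕ.+ N) (2^ N * p) (α * A + β * B) → Cong (n ℕ.+ N) (2^ N * q) (α * B + β * C) →
  Div n (A * q - B * p) → Div n (C * p - B * q) → Div N α × Div N β
cramer-divisible n N {A} {B} {C} {d} {α} {β} {p} {q} d-odd Δ≡ p≡ q≡ 2ⁿ∣Aq-Bp 2ⁿ∣Cp-Bq =
    divisible α (C * p - B * q) (by-div (subst (Div K) (sym (cramer-α A B C α β p q (2^ N)))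
                  (Div-minus K (Div-*ˡ K B (div q≡)) (Div-*ˡ K C (div p≡))))) 2ⁿ∣Cp-Bq
  , divisible β (A * q - B * p) (by-div (subst (Div K) (sym (cramer-β A B C α β p q (2^ N)))
                  (Div-minus K (Div-*ˡ K B (div p≡)) (Div-*ˡ K A (div q≡))))) 2ⁿ∣Aq-Bp
  where
  K : ℕ
  K = n ℕ.+ N
  cramer-α : ∀ A B C a b p q M → (A * C + - (B * B)) * a - M * (C * p - B * q)
                                 ≡ B * (M * q - (a * B + b * C)) - C * (M * p - (a * A + b * B))
  cramer-α = solve-∀
  cramer-β : ∀ A B C a b p q M → (A * C + - (B * B)) * b - M * (A * q - B * p)
                                 ≡ B * (M * p - (a * A + b * B)) - A * (M * q - (a * B + b * C))
  cramer-β = solve-∀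
  divisible : ∀ γ z → Cong K ((A * C + - (B * B)) * γ) (2^ N * z) → Div n z → Div N γ
  divisible γ z Δγ≡ 2ⁿ∣z = Div-cancel-odd N d-odd (Div-2^*-cancel N n (subst (Div K) (ℤP.*-assoc (2^ n) d γ)
    (Div-resp-Cong K (Cong-trans K (Cong-sym K (Cong-* K Δ≡ (Cong-refl K γ))) Δγ≡)
      (subst (Div K) (ℤP.*-comm z (2^ N)) (Div-* n N 2ⁿ∣z (Div-2^ N))))))

Cong-valuation : ∀ n k {x d} → n ℕ.< k → Cong k x (2^ n * d) → ¬ Div 1 d → Div n x × ¬ Div (suc n) x
Cong-valuation n k {x} {d} n<k x≡ d-odd =
    Div-resp-Cong n (Cong-mono n k (ℕP.<⇒≤ n<k) x≡) (Div-*ʳ n d (Div-2^ n))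
  , λ 2ⁿ⁺¹∣x → d-odd (Div-2^*-cancel 1 n (subst (λ j → Div j (2^ n * d)) (ℕP.+-comm 1 n)
                 (Div-resp-Cong (suc n) (Cong-sym (suc n) (Cong-mono (suc n) k n<k x≡)) 2ⁿ⁺¹∣x)))

Cong-linear : ∀ j k k′ {P P′ Q Q′} → j ≤ 4 → Cong 4 P P′ → Cong 4 Q Q′ → Cong j (k * P + k′ * Q) (k * P′ + k′ * Q′)
Cong-linear j k k′ j≤4 cP cQ = Cong-mono j 4 j≤4 (Cong-+ 4 (Cong-* 4 (Cong-refl 4 k) cP) (Cong-* 4 (Cong-refl 4 k′) cQ))

·V+V-comm : ∀ e f a b → ((a ·V e) +V (b ·V f)) ≃V ((b ·V f) +V (a ·V e))
·V+V-comm e f a b = by-coord λ i →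
    ≃Q-trans (≃Q-exact {((a ·V e) +V (b ·V f)) i} {(a *Q e i) +Q (b *Q f i)} λ k → refl)
    (≃Q-trans (+Q≃⊞ (a *Q e i) (b *Q f i)) (≃Q-trans (⊞-comm (a *Q e i) (b *Q f i))
    (≃Q-trans (≃Q-sym (+Q≃⊞ (b *Q f i) (a *Q e i))) (≃Q-exact {(b *Q f i) +Q (a *Q e i)} {((b ·V f) +V (a ·V e)) i} λ k → refl))))

IsZ2Basis-swap : ∀ {u v e f} → IsZ2Basis u v e f → IsZ2Basis u v f e
IsZ2Basis-swap {u} {v} {e} {f} (e∈ , f∈ , span , indep) = f∈ , e∈ , span′ , indep′
  where
  span′ : ∀ w → InLZ u v w → Σ Z2 λ β → Σ Z2 λ α → w ≈V ((ι β ·V f) +V (ι α ·V e))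
  span′ w w∈ = let (α , β , h) = span w w∈ in
    β , α , ≃V⇒≈V {w} {(ι β ·V f) +V (ι α ·V e)} (≃V-trans (≈V⇒≃V {w} {(ι α ·V e) +V (ι β ·V f)} h) (·V+V-comm e f (ι α) (ι β)))
  indep′ : ∀ β α → ((ι β ·V f) +V (ι α ·V e)) ≈V 0V → (β ≈Z fromℤ (+ 0)) × (α ≈Z fromℤ (+ 0))
  indep′ β α h = let (α≈0 , β≈0) = indep α β (≃V⇒≈V {(ι α ·V e) +V (ι β ·V f)} {0V}
                                   (≃V-trans (·V+V-comm e f (ι α) (ι β)) (≈V⇒≃V {(ι β ·V f) +V (ι α ·V e)} {0V} h)))
                 in β≈0 , α≈0

module Basis (u v e f : V4) (basis : IsZ2Basis u v e f) where

  e∈LZ : InLZ u v e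
  e∈LZ = proj₁ basis

  f∈LZ : InLZ u v f
  f∈LZ = proj₁ (proj₂ basis)

  E F : Fin 4 → Z2
  E = proj₁ (IntegralV⇒≃ιV e (proj₂ e∈LZ))
  F = proj₁ (IntegralV⇒≃ιV f (proj₂ f∈LZ))

  e≃E : e ≃V ιV E
  e≃E = proj₂ (IntegralV⇒≃ιV e (proj₂ e∈LZ))

  f≃F : f ≃V ιV F
  f≃F = proj₂ (IntegralV⇒≃ιV f (proj₂ f∈LZ))

  expand : ∀ w → InLZ u v w → Σ Z2 λ α → Σ Z2 λ β → w ≃V ((ι α ⊙ e) ⊕ (ι β ⊙ f))
  expand w w∈ = let (α , β , h) = proj₁ (proj₂ (proj₂ basis)) w w∈ in
    α , β , ≃V-trans (≈V⇒≃V {w} {(ι α ·V e) +V (ι β ·V f)} h) (·V+V≃⊙⊕ (ι α) e (ι β) f)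

  independent : ∀ α β → ((ι α ⊙ e) ⊕ (ι β ⊙ f)) ≃V (λ _ → 0q) → (α ≈Z fromℤ (+ 0)) × (β ≈Z fromℤ (+ 0))
  independent α β h = proj₂ (proj₂ (proj₂ basis)) α β
    (≃V⇒≈V {(ι α ·V e) +V (ι β ·V f)} {0V} (≃V-trans (·V+V≃⊙⊕ (ι α) e (ι β) f) (≃V-trans h (≃V-sym 0V≃))))

  A B C Δ : Z2
  A = dotZ E E
  B = dotZ E F
  C = dotZ F F
  Δ = (A *Z C) +Z (-Z (B *Z B))

  dot-ee : dot e e ≃Q ι A
  dot-ee = ≃Q-trans (dot-cong e≃E e≃E) (dot-ιV E E)

  dot-ef : dot e f ≃Q ι B
  dot-ef = ≃Q-trans (dot-cong e≃E f≃F) (dot-ιV E F)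

  dot-fe : dot f e ≃Q ι B
  dot-fe = ≃Q-trans (dot-comm f e) dot-ef

  dot-ff : dot f f ≃Q ι C
  dot-ff = ≃Q-trans (dot-cong f≃F f≃F) (dot-ιV F F)

  gramDet≃Δ : gramDet e f ≃Q ι Δ
  gramDet≃Δ =
    ≃Q-trans (≃Q-exact {gramDet e f} {(⟨ e , e ⟩ *Q ⟨ f , f ⟩) +Q (-Q (⟨ e , f ⟩ *Q ⟨ e , f ⟩))} λ k → refl)
    (≃Q-trans (+Q≃⊞ (⟨ e , e ⟩ *Q ⟨ f , f ⟩) (-Q (⟨ e , f ⟩ *Q ⟨ e , f ⟩)))
    (≃Q-trans (⊞-cong (≃Q-trans (*Q≃⊠ ⟨ e , e ⟩ ⟨ f , f ⟩) (⊠-cong (≃Q-trans (⟨⟩≃dot e e) dot-ee) (≃Q-trans (⟨⟩≃dot f f) dot-ff)))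
                      (≃Q-trans (-Q≃⊟ (⟨ e , f ⟩ *Q ⟨ e , f ⟩))
                        (⊟-cong (≃Q-trans (*Q≃⊠ ⟨ e , f ⟩ ⟨ e , f ⟩) (⊠-cong (≃Q-trans (⟨⟩≃dot e f) dot-ef) (≃Q-trans (⟨⟩≃dot e f) dot-ef))))))
    (≃Q-sym (≃Q-trans (ι-+ (A *Z C) (-Z (B *Z B))) (⊞-cong (ι-* A C) (≃Q-trans (ι-neg (B *Z B)) (⊟-cong (ι-* B B))))))))

  dot-combination-e : ∀ α β → dot ((ι α ⊙ e) ⊕ (ι β ⊙ f)) e ≃Q ι ((α *Z A) +Z (β *Z B))
  dot-combination-e α β = ≃Q-trans (dot-linearˡ (ι α) e (ι β) f e)
    (≃Q-trans (⊞-cong (⊠-cong (≃Q-refl (ι α)) dot-ee) (⊠-cong (≃Q-refl (ι β)) dot-fe)) (ι-linear α A β B))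

  dot-combination-f : ∀ α β → dot ((ι α ⊙ e) ⊕ (ι β ⊙ f)) f ≃Q ι ((α *Z B) +Z (β *Z C))
  dot-combination-f α β = ≃Q-trans (dot-linearˡ (ι α) e (ι β) f f)
    (≃Q-trans (⊞-cong (⊠-cong (≃Q-refl (ι α)) dot-ef) (⊠-cong (≃Q-refl (ι β)) dot-ff)) (ι-linear α B β C))

  InDual-intro : ∀ {x} p q → InL≃ u v x → dot x e ≃Q ι p → dot x f ≃Q ι q → InDual u v x
  InDual-intro {x} p q x∈L xe xf = InL≃⇒InL x∈L , integral
    where
    integral : ∀ w → InLZ u v w → IsIntQ ⟨ x , w ⟩
    integral w w∈ = let (α , β , w≃) = expand w w∈ in ≃ι⇒IsIntQ {⟨ x , w ⟩} {(α *Z p) +Z (β *Z q)}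
      (≃Q-trans (⟨⟩≃dot x w) (≃Q-trans (dot-cong (≃V-refl x) w≃) (≃Q-trans (dot-linearʳ x (ι α) e (ι β) f)
      (≃Q-trans (⊞-cong (⊠-cong (≃Q-refl (ι α)) xe) (⊠-cong (≃Q-refl (ι β)) xf)) (ι-linear α p β q)))))

  pairing : ∀ g → InLZ u v g → Dual u v → Z2
  pairing g g∈ (x , _ , x-dual) = proj₁ (IsIntQ⇒≃ι {⟨ x , g ⟩} (x-dual g g∈))

  dot≃pairing : ∀ g g∈ (x : Dual u v) → dot (proj₁ x) g ≃Q ι (pairing g g∈ x)
  dot≃pairing g g∈ (x , _ , x-dual) = ≃Q-trans (≃Q-sym (⟨⟩≃dot x g)) (proj₂ (IsIntQ⇒≃ι {⟨ x , g ⟩} (x-dual g g∈)))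

  pairing-+ : ∀ g g∈ (x y z : Dual u v) → proj₁ z ≈V (proj₁ x +V proj₁ y) →
              pairing g g∈ z ≃Z (pairing g g∈ x +Z pairing g g∈ y)
  pairing-+ g g∈ x y z z≈ = ι-injective (≃Q-trans (≃Q-sym (dot≃pairing g g∈ z))
    (≃Q-trans (dot-cong (≃V-trans (≈V⇒≃V {proj₁ z} {proj₁ x +V proj₁ y} z≈) (+V≃⊕ (proj₁ x) (proj₁ y))) (≃V-refl g))
    (≃Q-trans (dot-⊕ˡ (proj₁ x) (proj₁ y) g)
    (≃Q-trans (⊞-cong (dot≃pairing g g∈ x) (dot≃pairing g g∈ y)) (≃Q-sym (ι-+ (pairing g g∈ x) (pairing g g∈ y)))))))

  pairing-difference : ∀ g g∈ (x y : Dual u v) →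
    ι (pairing g g∈ x +Z (-Z pairing g g∈ y)) ≃Q dot (proj₁ x -V proj₁ y) g
  pairing-difference g g∈ x y = ≃Q-trans (ι-+ (pairing g g∈ x) (-Z pairing g g∈ y))
    (≃Q-trans (⊞-cong (≃Q-sym (dot≃pairing g g∈ x)) (≃Q-trans (ι-neg (pairing g g∈ y)) (⊟-cong (≃Q-sym (dot≃pairing g g∈ y)))))
    (≃Q-trans (⊞-cong (≃Q-refl (dot (proj₁ x) g)) (≃Q-sym (dot-⊖ˡ (proj₁ y) g)))
    (≃Q-trans (≃Q-sym (dot-⊕ˡ (proj₁ x) (⊖ (proj₁ y)) g)) (dot-cong (≃V-sym (-V≃⊕⊖ (proj₁ x) (proj₁ y))) (≃V-refl g)))))

  expand-scaled : ∀ w → InL≃ u v w → Σ ℕ λ N → Σ Z2 λ α → Σ Z2 λ β → (czq (2^ N) ⊙ w) ≃V ((ι α ⊙ e) ⊕ (ι β ⊙ f))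
  expand-scaled w w∈L = let (N , W , 2^Nw≃W) = clear-denominators w
                            (α , β , 2^Nw≃) = expand (czq (2^ N) ⊙ w) (InL≃⇒InL (InL≃-⊙ (czq (2^ N)) w∈L) , ≃ιV⇒IntegralV 2^Nw≃W)
                        in N , α , β , 2^Nw≃

  integral-if-coefficients-divisible : ∀ w N α β → (czq (2^ N) ⊙ w) ≃V ((ι α ⊙ e) ⊕ (ι β ⊙ f)) →
    Div N (seq α N) → Div N (seq β N) → IntegralV w
  integral-if-coefficients-divisible w N α β 2^Nw≃ 2^N∣α 2^N∣β =
    ≃ιV⇒IntegralV {w} {λ i → (α′ *Z E i) +Z (β′ *Z F i)} (by-coord λ i →
      ≃Q-trans (2^⊠-cancel N (w i) (((ι α′ ⊙ e) ⊕ (ι β′ ⊙ f)) i) (coord 2^Nw≃2^N[α′e+β′f] i))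
      (≃Q-trans (⊞-cong (⊠-cong (≃Q-refl (ι α′)) (coord e≃E i)) (⊠-cong (≃Q-refl (ι β′)) (coord f≃F i))) (ι-linear α′ (E i) β′ (F i))))
    where
    M : Q2
    M = czq (2^ N)
    α′-spec : Σ Z2 λ c → (c *Z pow2Z N) ≃Z α
    α′-spec = Z2-exact-div α N 2^N∣α
    β′-spec : Σ Z2 λ c → (c *Z pow2Z N) ≃Z β
    β′-spec = Z2-exact-div β N 2^N∣β
    α′ β′ : Z2
    α′ = proj₁ α′-spec
    β′ = proj₁ β′-spec
    ι-divided : ∀ {γ} (γ′ : Σ Z2 λ c → (c *Z pow2Z N) ≃Z γ) → ι γ ≃Q (ι (proj₁ γ′) ⊠ M)
    ι-divided (c , c2^N≃γ) = ≃Q-trans (ι-cong (≃Z-sym c2^N≃γ))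
      (≃Q-trans (ι-* c (pow2Z N)) (⊠-cong (≃Q-refl (ι c)) (≃Q-reflexive (ι-fromℤ≡czq (2^ N)))))
    factor : ∀ M a b E F → (((a ⊠ M) ⊠ E) ⊞ ((b ⊠ M) ⊠ F)) ≃Q (M ⊠ ((a ⊠ E) ⊞ (b ⊠ F)))
    factor = solve 5 (λ M a b E F → (((a :* M) :* E) :+ ((b :* M) :* F)) := (M :* ((a :* E) :+ (b :* F)))) (≃Q-refl _)
    2^Nw≃2^N[α′e+β′f] : (M ⊙ w) ≃V (M ⊙ ((ι α′ ⊙ e) ⊕ (ι β′ ⊙ f)))
    2^Nw≃2^N[α′e+β′f] = ≃V-trans 2^Nw≃ (by-coord λ i →
      ≃Q-trans (⊞-cong (⊠-cong (ι-divided α′-spec) (≃Q-refl (e i))) (⊠-cong (ι-divided β′-spec) (≃Q-refl (f i))))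
               (factor M (ι α′) (ι β′) (e i) (f i)))

  -- Saturation of L(ℤ₂) = L ∩ ℤ₂⁴: with G = A f - B e we have ⟨G,G⟩ = AΔ and
  -- ⟨G,e⟩ = 0, so if 4 ∣ Δ and A were odd, G would be divisible by 2 in ℤ₂⁴,
  -- hence G/2 ∈ L(ℤ₂) = ℤ₂e + ℤ₂f, and comparing coefficients of f makes A even.
  module Saturation where

    G : Fin 4 → Z2
    G i = (A *Z F i) +Z (-Z (B *Z E i))

    ιG≃ : ∀ i → ιV G i ≃Q ((ι A ⊠ f i) ⊞ ⊟ (ι B ⊠ e i))
    ιG≃ i = ≃Q-trans (ι-+ (A *Z F i) (-Z (B *Z E i)))
      (⊞-cong (≃Q-trans (ι-* A (F i)) (⊠-cong (≃Q-refl (ι A)) (≃Q-sym (coord f≃F i))))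
              (≃Q-trans (ι-neg (B *Z E i)) (⊟-cong (≃Q-trans (ι-* B (E i)) (⊠-cong (≃Q-refl (ι B)) (≃Q-sym (coord e≃E i)))))))

    G∈L : InL≃ u v (ιV G)
    G∈L = InL≃-resp (by-coord ιG≃)
      (InL≃-⊕ (InL≃-⊙ (ι A) (InL⇒InL≃ (proj₁ f∈LZ))) (InL≃-⊖ (InL≃-⊙ (ι B) (InL⇒InL≃ (proj₁ e∈LZ)))))

    G-even : Div 2 (seq Δ 4) → Odd (seq A 4) → ∀ i → Div 1 (seq (G i) 1)
    G-even 4∣Δ A-odd i = Div-seq (G i) 1 (s≤s z≤n) ℕP.≤-refl (even-at-4 i)
      where
      e′ f′ : Fin 4 → ℤ
      e′ i = seq (E i) 4
      f′ i = seq (F i) 4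
      norm : ∀ e0 e1 e2 e3 f0 f1 f2 f3 →
        let A = e0 * e0 + (e1 * e1 + (e2 * e2 + e3 * e3))
            B = e0 * f0 + (e1 * f1 + (e2 * f2 + e3 * f3))
            C = f0 * f0 + (f1 * f1 + (f2 * f2 + f3 * f3))
            g0 = A * f0 + - (B * e0)
            g1 = A * f1 + - (B * e1)
            g2 = A * f2 + - (B * e2)
            g3 = A * f3 + - (B * e3)
        in g0 * g0 + (g1 * g1 + (g2 * g2 + g3 * g3)) ≡ A * (A * C + - (B * B))
      norm = solve-∀
      orthogonal : ∀ e0 e1 e2 e3 f0 f1 f2 f3 →
        let A = e0 * e0 + (e1 * e1 + (e2 * e2 + e3 * e3))
            B = e0 * f0 + (e1 * f1 + (e2 * f2 + e3 * f3))
            g0 = A * f0 + - (B * e0)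
            g1 = A * f1 + - (B * e1)
            g2 = A * f2 + - (B * e2)
            g3 = A * f3 + - (B * e3)
        in g0 * e0 + (g1 * e1 + (g2 * e2 + g3 * e3)) ≡ + 0
      orthogonal = solve-∀
      all-even : Div 1 (seq (G i0) 4) × Div 1 (seq (G i1) 4) × Div 1 (seq (G i2) 4) × Div 1 (seq (G i3) 4)
      all-even = four-squares-even _ _ _ _ (e′ i0) (e′ i1) (e′ i2) (e′ i3)
        (subst (Div 2) (sym (norm (e′ i0) (e′ i1) (e′ i2) (e′ i3) (f′ i0) (f′ i1) (f′ i2) (f′ i3))) (Div-*ˡ 2 (seq A 4) 4∣Δ))
        (orthogonal (e′ i0) (e′ i1) (e′ i2) (e′ i3) (f′ i0) (f′ i1) (f′ i2) (f′ i3))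
        (odd⇒¬even A-odd)
      even-at-4 : ∀ i → Div 1 (seq (G i) 4)
      even-at-4 i0 = proj₁ all-even
      even-at-4 i1 = proj₁ (proj₂ all-even)
      even-at-4 i2 = proj₁ (proj₂ (proj₂ all-even))
      even-at-4 i3 = proj₂ (proj₂ (proj₂ all-even))

    A-even-if-G-even : (∀ i → Div 1 (seq (G i) 1)) → Div 1 (seq A 4)
    A-even-if-G-even G-even = Div-seq A 1 ℕP.≤-refl (s≤s z≤n) A₁-even
      where
      two : Q2
      two = czq (+ 2)
      H : Fin 4 → Z2
      H = proj₁ (Z2-halve G G-even)
      G≃2H : ∀ i → ιV G i ≃Q (two ⊠ ιV H i)
      G≃2H = proj₂ (Z2-halve G G-even)
      H∈L : InL≃ u v (ιV H)
      H∈L = InL≃-resp (by-coord λ i → ≃Q-trans (≃Q-sym (half^⊠2^ 1 (ιV H i))) (⊠-cong (≃Q-refl (half^ 1)) (≃Q-sym (G≃2H i))))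
                      (InL≃-⊙ (half^ 1) G∈L)
      H-coeffs : Σ Z2 λ γ → Σ Z2 λ η → ιV H ≃V ((ι γ ⊙ e) ⊕ (ι η ⊙ f))
      H-coeffs = expand (ιV H) (InL≃⇒InL H∈L , ≃ιV⇒IntegralV (≃V-refl (ιV H)))
      γ η α₀ β₀ : Z2
      γ = proj₁ H-coeffs
      η = proj₁ (proj₂ H-coeffs)
      α₀ = (-Z B) +Z (-Z (fromℤ (+ 2) *Z γ))
      β₀ = A +Z (-Z (fromℤ (+ 2) *Z η))
      ι-neg-2* : ∀ x → ι (-Z (fromℤ (+ 2) *Z x)) ≃Q ⊟ (two ⊠ ι x)
      ι-neg-2* x = ≃Q-trans (ι-neg (fromℤ (+ 2) *Z x))
                 (⊟-cong (≃Q-trans (ι-* (fromℤ (+ 2)) x) (⊠-cong (≃Q-reflexive (ι-fromℤ≡czq (+ 2))) (≃Q-refl (ι x)))))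
      collect : ∀ a b g h two E F → (((⊟ b ⊞ ⊟ (two ⊠ g)) ⊠ E) ⊞ ((a ⊞ ⊟ (two ⊠ h)) ⊠ F))
                                    ≃Q (((a ⊠ F) ⊞ ⊟ (b ⊠ E)) ⊞ ⊟ (two ⊠ ((g ⊠ E) ⊞ (h ⊠ F))))
      collect = solve 7 (λ a b g h two E F → ((((:- b) :- (two :* g)) :* E) :+ ((a :- (two :* h)) :* F))
                                           := (((a :* F) :- (b :* E)) :- (two :* ((g :* E) :+ (h :* F))))) (≃Q-refl _)
      cancel : ∀ x → (x ⊞ ⊟ x) ≃Q czq (+ 0)
      cancel = solve 1 (λ x → (x :- x) := con (+ 0)) (≃Q-refl _)
      relation : ((ι α₀ ⊙ e) ⊕ (ι β₀ ⊙ f)) ≃V (λ _ → 0q)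
      relation = by-coord λ i →
        ≃Q-trans (⊞-cong (⊠-cong (≃Q-trans (ι-+ (-Z B) (-Z (fromℤ (+ 2) *Z γ))) (⊞-cong (ι-neg B) (ι-neg-2* γ))) (≃Q-refl (e i)))
                         (⊠-cong (≃Q-trans (ι-+ A (-Z (fromℤ (+ 2) *Z η))) (⊞-cong (≃Q-refl (ι A)) (ι-neg-2* η))) (≃Q-refl (f i))))
        (≃Q-trans (collect (ι A) (ι B) (ι γ) (ι η) two (e i) (f i))
        (≃Q-trans (⊞-cong (≃Q-sym (ιG≃ i))
                          (⊟-cong (≃Q-trans (⊠-cong (≃Q-refl two) (≃Q-sym (coord (proj₂ (proj₂ H-coeffs)) i))) (≃Q-sym (G≃2H i)))))
        (≃Q-trans (cancel (ιV G i)) czq-0)))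
      A₁-even : Div 1 (seq A 1)
      A₁-even = Div-resp-Cong 1 (by-div (subst (Div 1) (rearrange (seq A 1) (seq η 1))
        (Div-+ 1 (proj₂ (independent α₀ β₀ relation) 1) (Div-*ˡ 1 (seq η 1) (Div-2^ 1))))) (Div-zero 1)
        where
        rearrange : ∀ a h → ((a + - (+ 2 * h)) - + 0) + h * + 2 ≡ a - + 0
        rearrange = solve-∀

    A-even : Div 2 (seq Δ 4) → Div 1 (seq A 4)
    A-even 4∣Δ = [ (λ even → even) , (λ odd → ⊥-elim (odd⇒¬even odd (A-even-if-G-even (G-even 4∣Δ odd)))) ]′ (parity (seq A 4))

  -- All congruences involved are modulo at most 2^4 (n ≤ 3, m ≤ 2), so they are read off at level 4.
  module Glue (n m : ℕ) (1≤n : 1 ≤ n) (n≤3 : n ≤ 3) (m≤2 : m ≤ 2)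
    (δ : Z2) (δ-unit : IsUnitZ δ) (Δ≃ : Δ ≃Z (pow2Z n *Z δ))
    (forms : GlueForms n m (seq A 4) (seq B 4) (seq C 4)) where

    open GlueForms forms

    n≤4 : n ≤ 4
    n≤4 = ℕP.m≤n⇒m≤1+n n≤3

    m≤4 : m ≤ 4
    m≤4 = ℕP.≤-trans m≤2 (s≤s (s≤s z≤n))

    P Q : Dual u v → Z2
    P = pairing e e∈LZ
    Q = pairing f f∈LZ

    φ : Dual u v → ℤ × ℤ
    φ x = ℓ₁ (seq (P x) 4) (seq (Q x) 4) , ℓ₂ (seq (P x) 4) (seq (Q x) 4)

    ℓ-difference : ∀ k k′ a b c d → (k * a + k′ * c) - (k * b + k′ * d) ≡ k * (a - b) + k′ * (c - d)
    ℓ-difference = solve-∀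

    φ-additive : ∀ (x y z : Dual u v) → proj₁ z ≈V (proj₁ x +V proj₁ y) → φ z ≈T[ m ] (φ x +T φ y)
    φ-additive x y z z≈ =
        div (Cong-trans 1 (Cong-linear 1 k₁ k₂ (s≤s z≤n) cP cQ) (Cong-reflexive 1 (ℓ-+ k₁ k₂)))
      , div (Cong-trans m (Cong-linear m k₃ k₄ m≤4 cP cQ) (Cong-reflexive m (ℓ-+ k₃ k₄)))
      where
      cP : Cong 4 (seq (P z) 4) (seq (P x) 4 + seq (P y) 4)
      cP = at (pairing-+ e e∈LZ x y z z≈) 4
      cQ : Cong 4 (seq (Q z) 4) (seq (Q x) 4 + seq (Q y) 4)
      cQ = at (pairing-+ f f∈LZ x y z z≈) 4
      ℓ-+ : ∀ k k′ → k * (seq (P x) 4 + seq (P y) 4) + k′ * (seq (Q x) 4 + seq (Q y) 4)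
                     ≡ (k * seq (P x) 4 + k′ * seq (Q x) 4) + (k * seq (P y) 4 + k′ * seq (Q y) 4)
      ℓ-+ k k′ = distribute k k′ (seq (P x) 4) (seq (P y) 4) (seq (Q x) 4) (seq (Q y) 4)
        where
        distribute : ∀ k k′ a b c d → k * (a + b) + k′ * (c + d) ≡ (k * a + k′ * c) + (k * b + k′ * d)
        distribute = solve-∀

    pairings-of-difference : ∀ (x y : Dual u v) α β → (proj₁ x -V proj₁ y) ≃V ((ι α ⊙ e) ⊕ (ι β ⊙ f)) →
      ((pairing e e∈LZ x +Z (-Z pairing e e∈LZ y)) ≃Z ((α *Z A) +Z (β *Z B))) × ((pairing f f∈LZ x +Z (-Z pairing f f∈LZ y)) ≃Z ((α *Z B) +Z (β *Z C)))
    pairings-of-difference x y α β w≃ =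
        ι-injective {pairing e e∈LZ x +Z (-Z pairing e e∈LZ y)} {(α *Z A) +Z (β *Z B)} (≃Q-trans (pairing-difference e e∈LZ x y) (≃Q-trans (dot-cong w≃ (≃V-refl e)) (dot-combination-e α β)))
      , ι-injective {pairing f f∈LZ x +Z (-Z pairing f f∈LZ y)} {(α *Z B) +Z (β *Z C)} (≃Q-trans (pairing-difference f f∈LZ x y) (≃Q-trans (dot-cong w≃ (≃V-refl f)) (dot-combination-f α β)))

    kernel⇒ : ∀ (x y : Dual u v) → InLZ u v (proj₁ x -V proj₁ y) → φ x ≈T[ m ] φ y
    kernel⇒ x y w∈ =
        subst (Div 1) (sym (ℓ-difference k₁ k₂ _ _ _ _)) (Div-resp-Cong 1 (Cong-linear 1 k₁ k₂ (s≤s z≤n) cP cQ) (proj₁ image))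
      , subst (Div m) (sym (ℓ-difference k₃ k₄ _ _ _ _)) (Div-resp-Cong m (Cong-linear m k₃ k₄ m≤4 cP cQ) (proj₂ image))
      where
      coeffs : Σ Z2 λ α → Σ Z2 λ β → (proj₁ x -V proj₁ y) ≃V ((ι α ⊙ e) ⊕ (ι β ⊙ f))
      coeffs = expand (proj₁ x -V proj₁ y) w∈
      α β : Z2
      α = proj₁ coeffs
      β = proj₁ (proj₂ coeffs)
      pairings : ((pairing e e∈LZ x +Z (-Z pairing e e∈LZ y)) ≃Z ((α *Z A) +Z (β *Z B))) × ((pairing f f∈LZ x +Z (-Z pairing f f∈LZ y)) ≃Z ((α *Z B) +Z (β *Z C)))
      pairings = pairings-of-difference x y α β (proj₂ (proj₂ coeffs))
      swap : ∀ a b A B → a * A + b * B ≡ A * a + B * b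
      swap = solve-∀
      cP : Cong 4 (seq (P x) 4 - seq (P y) 4) (seq A 4 * seq α 4 + seq B 4 * seq β 4)
      cP = Cong-trans 4 (at (proj₁ pairings) 4) (Cong-reflexive 4 (swap (seq α 4) (seq β 4) (seq A 4) (seq B 4)))
      cQ : Cong 4 (seq (Q x) 4 - seq (Q y) 4) (seq B 4 * seq α 4 + seq C 4 * seq β 4)
      cQ = Cong-trans 4 (at (proj₂ pairings) 4) (Cong-reflexive 4 (swap (seq α 4) (seq β 4) (seq B 4) (seq C 4)))
      image : Div 1 (ℓ₁ (seq A 4 * seq α 4 + seq B 4 * seq β 4) (seq B 4 * seq α 4 + seq C 4 * seq β 4))
            × Div m (ℓ₂ (seq A 4 * seq α 4 + seq B 4 * seq β 4) (seq B 4 * seq α 4 + seq C 4 * seq β 4))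
      image = kills-image (seq α 4) (seq β 4)

    δ-odd : ∀ k → 1 ≤ k → ¬ Div 1 (seq δ k)
    δ-odd k = unit-seq-odd δ k δ-unit

    -- 2^N·(p, q) = G·(α, β) for the coefficients of 2^N·w, and Cramer's rule shows 2^N ∣ α, β.
    integral-if-adjugate-divisible : ∀ w p q → InL≃ u v w → dot w e ≃Q ι p → dot w f ≃Q ι q →
      Div n (seq A 4 * seq q 4 - seq B 4 * seq p 4) → Div n (seq C 4 * seq p 4 - seq B 4 * seq q 4) → IntegralV w
    integral-if-adjugate-divisible w p q w∈L we wf 2ⁿ∣Aq-Bp 2ⁿ∣Cp-Bq =
      integral-if-coefficients-divisible w N α β 2^Nw≃
        (Div-seq α N (ℕP.m≤n+m N n) ℕP.≤-refl (proj₁ 2^N∣αβ)) (Div-seq β N (ℕP.m≤n+m N n) ℕP.≤-refl (proj₂ 2^N∣αβ))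
      where
      scaled : Σ ℕ λ N → Σ Z2 λ α → Σ Z2 λ β → (czq (2^ N) ⊙ w) ≃V ((ι α ⊙ e) ⊕ (ι β ⊙ f))
      scaled = expand-scaled w w∈L
      N : ℕ
      N = proj₁ scaled
      α β : Z2
      α = proj₁ (proj₂ scaled)
      β = proj₁ (proj₂ (proj₂ scaled))
      2^Nw≃ : (czq (2^ N) ⊙ w) ≃V ((ι α ⊙ e) ⊕ (ι β ⊙ f))
      2^Nw≃ = proj₂ (proj₂ (proj₂ scaled))
      scaled-pairing : ∀ g r → dot w g ≃Q ι r → ι (pow2Z N *Z r) ≃Q dot ((ι α ⊙ e) ⊕ (ι β ⊙ f)) g
      scaled-pairing g r wg = ≃Q-trans (ι-* (pow2Z N) r) (≃Q-trans (⊠-cong (≃Q-reflexive (ι-fromℤ≡czq (2^ N))) (≃Q-sym wg))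
        (≃Q-trans (≃Q-sym (dot-⊙ˡ (czq (2^ N)) w g)) (dot-cong 2^Nw≃ (≃V-refl g))))
      K : ℕ
      K = n ℕ.+ N
      Np≡ : Cong K (2^ N * seq p K) (seq α K * seq A K + seq β K * seq B K)
      Np≡ = at (ι-injective {pow2Z N *Z p} {(α *Z A) +Z (β *Z B)} (≃Q-trans (scaled-pairing e p we) (dot-combination-e α β))) K
      Nq≡ : Cong K (2^ N * seq q K) (seq α K * seq B K + seq β K * seq C K)
      Nq≡ = at (ι-injective {pow2Z N *Z q} {(α *Z B) +Z (β *Z C)} (≃Q-trans (scaled-pairing f q wf) (dot-combination-f α β))) K
      n≤K : n ≤ K
      n≤K = ℕP.m≤m+n n N
      2^N∣αβ : Div N (seq α K) × Div N (seq β K)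
      2^N∣αβ = cramer-divisible n N (δ-odd K (ℕP.≤-trans 1≤n n≤K)) (at Δ≃ K) Np≡ Nq≡
        (Div-seq ((A *Z q) +Z (-Z (B *Z p))) n n≤4 n≤K 2ⁿ∣Aq-Bp) (Div-seq ((C *Z p) +Z (-Z (B *Z q))) n n≤4 n≤K 2ⁿ∣Cp-Bq)

    kernel⇐ : ∀ (x y : Dual u v) → φ x ≈T[ m ] φ y → InLZ u v (proj₁ x -V proj₁ y)
    kernel⇐ x y (d₁ , d₂) = InL≃⇒InL w∈L ,
      integral-if-adjugate-divisible w p q w∈L (≃Q-sym (pairing-difference e e∈LZ x y)) (≃Q-sym (pairing-difference f f∈LZ x y))
        (proj₁ adjugate) (proj₂ adjugate)
      where
      w : V4
      w = proj₁ x -V proj₁ y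
      w∈L : InL≃ u v w
      w∈L = InL≃-resp (-V≃⊕⊖ (proj₁ x) (proj₁ y))
              (InL≃-⊕ (InL⇒InL≃ (proj₁ (proj₂ x))) (InL≃-⊖ (InL⇒InL≃ (proj₁ (proj₂ y)))))
      p q : Z2
      p = pairing e e∈LZ x +Z (-Z pairing e e∈LZ y)
      q = pairing f f∈LZ x +Z (-Z pairing f f∈LZ y)
      adjugate : Div n (seq A 4 * seq q 4 - seq B 4 * seq p 4) × Div n (seq C 4 * seq p 4 - seq B 4 * seq q 4)
      adjugate = kernel⊆image (seq p 4) (seq q 4)
        (subst (Div 1) (ℓ-difference k₁ k₂ _ _ _ _) d₁) (subst (Div m) (ℓ-difference k₃ k₄ _ _ _ _) d₂)

    -- x = 2^(-n) ((Cp - Bq) e + (Aq - Bp) f) pairs with (e, f) to δ·(p, q).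
    dual-with-pairings : ∀ p q → Σ (Dual u v) λ x → (P x ≃Z (δ *Z p)) × (Q x ≃Z (δ *Z q))
    dual-with-pairings p q = (x , x-dual) ,
      ι-injective {P (x , x-dual)} {δ *Z p} (≃Q-trans (≃Q-sym (dot≃pairing e e∈LZ (x , x-dual))) xe) ,
      ι-injective {Q (x , x-dual)} {δ *Z q} (≃Q-trans (≃Q-sym (dot≃pairing f f∈LZ (x , x-dual))) xf)
      where
      r s : Z2
      r = (C *Z p) +Z (-Z (B *Z q))
      s = (A *Z q) +Z (-Z (B *Z p))
      y x : V4
      y = (ι r ⊙ e) ⊕ (ι s ⊙ f)
      x = half^ n ⊙ y
      adjugate-e : ∀ A B C p q → ((C * p + - (B * q)) * A + (A * q + - (B * p)) * B) ≡ (A * C + - (B * B)) * p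
      adjugate-e = solve-∀
      adjugate-f : ∀ A B C p q → ((C * p + - (B * q)) * B + (A * q + - (B * p)) * C) ≡ (A * C + - (B * B)) * q
      adjugate-f = solve-∀
      x∈L : InL≃ u v x
      x∈L = InL≃-⊙ (half^ n) (InL≃-⊕ (InL≃-⊙ (ι r) (InL⇒InL≃ (proj₁ e∈LZ))) (InL≃-⊙ (ι s) (InL⇒InL≃ (proj₁ f∈LZ))))
      Δ*≃ : ∀ c → (Δ *Z c) ≃Z (pow2Z n *Z (δ *Z c))
      Δ*≃ c = ≃Z-trans {Δ *Z c} {(pow2Z n *Z δ) *Z c} {pow2Z n *Z (δ *Z c)} (*Z-cong {Δ} {pow2Z n *Z δ} {c} {c} Δ≃ (≃Z-refl c)) (*Z-assoc (pow2Z n) δ c)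
      halve : ∀ g t c → dot y g ≃Q ι t → t ≃Z (Δ *Z c) → dot x g ≃Q ι (δ *Z c)
      halve g t c yg t≃ = ≃Q-trans (dot-⊙ˡ (half^ n) y g)
        (≃Q-trans (⊠-cong (≃Q-refl (half^ n)) (≃Q-trans yg (ι-cong (≃Z-trans t≃ (Δ*≃ c))))) (half^⊠ι2^ n (δ *Z c)))
      xe : dot x e ≃Q ι (δ *Z p)
      xe = halve e ((r *Z A) +Z (s *Z B)) p (dot-combination-e r s)
             (≃Z-pointwise λ k → adjugate-e (seq A k) (seq B k) (seq C k) (seq p k) (seq q k))
      xf : dot x f ≃Q ι (δ *Z q)
      xf = halve f ((r *Z B) +Z (s *Z C)) q (dot-combination-f r s)
             (≃Z-pointwise λ k → adjugate-f (seq A k) (seq B k) (seq C k) (seq p k) (seq q k))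
      x-dual : InDual u v x
      x-dual = InDual-intro (δ *Z p) (δ *Z q) x∈L xe xf

    -- Lifting (P₀, Q₀) by s = δ mod 16 works because s² ≡ 1 mod 4 and m ≤ 2.
    φ-surjective : ∀ (t : ℤ × ℤ) → Σ (Dual u v) λ x → φ x ≈T[ m ] t
    φ-surjective (t₁ , t₂) = x , div (Cong-trans 1 (≈-lifted 1 (s≤s z≤n) k₁ k₂) c₁) , div (Cong-trans m (≈-lifted m m≤2 k₃ k₄) c₂)
      where
      preimage : Σ ℤ λ P₀ → Σ ℤ λ Q₀ → Cong 1 (ℓ₁ P₀ Q₀) t₁ × Cong m (ℓ₂ P₀ Q₀) t₂
      preimage = onto t₁ t₂
      P₀ Q₀ s : ℤ
      P₀ = proj₁ preimage
      Q₀ = proj₁ (proj₂ preimage)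
      s = seq δ 4
      c₁ : Cong 1 (ℓ₁ P₀ Q₀) t₁
      c₁ = proj₁ (proj₂ (proj₂ preimage))
      c₂ : Cong m (ℓ₂ P₀ Q₀) t₂
      c₂ = proj₂ (proj₂ (proj₂ preimage))
      lifted : Σ (Dual u v) λ x → (P x ≃Z (δ *Z fromℤ (s * P₀))) × (Q x ≃Z (δ *Z fromℤ (s * Q₀)))
      lifted = dual-with-pairings (fromℤ (s * P₀)) (fromℤ (s * Q₀))
      x : Dual u v
      x = proj₁ lifted
      ≈-lifted : ∀ j → j ≤ 2 → ∀ k k′ → Cong j (k * seq (P x) 4 + k′ * seq (Q x) 4) (k * P₀ + k′ * Q₀)
      ≈-lifted j j≤2 k k′ = Cong-mono j 2 j≤2 (Cong-trans 2
        (Cong-linear 2 k k′ (s≤s (s≤s z≤n)) (at (proj₁ (proj₂ lifted)) 4) (at (proj₂ (proj₂ lifted)) 4))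
        (by-div (subst (Div 2) (sym (square-factor k k′ P₀ Q₀ s)) (Div-*ʳ 2 (k * P₀ + k′ * Q₀) (odd-square (δ-odd 4 (s≤s z≤n)))))))
        where
        square-factor : ∀ k k′ P₀ Q₀ s → (k * (s * (s * P₀)) + k′ * (s * (s * Q₀))) - (k * P₀ + k′ * Q₀) ≡ (s * s - + 1) * (k * P₀ + k′ * Q₀)
        square-factor = solve-∀

    glue-iso : GlueIso u v m
    glue-iso = φ , (λ x y → mk⇔ (kernel⇒ x y) (kernel⇐ x y)) , φ-additive , φ-surjective

Gram-even : ∀ u v e f (basis : IsZ2Basis u v e f) → Div 2 (seq (Basis.Δ u v e f basis) 4) →
  Div 1 (seq (Basis.A u v e f basis) 4) × Div 1 (seq (Basis.B u v e f basis) 4) × Div 1 (seq (Basis.C u v e f basis) 4)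
Gram-even u v e f basis 4∣Δ = 2∣A , even-diagonal⇒even _ _ _ 2∣A (Div-mono 1 2 (s≤s z≤n) 4∣Δ) , 2∣C
  where
  2∣A : Div 1 (seq (Basis.A u v e f basis) 4)
  2∣A = Basis.Saturation.A-even u v e f basis 4∣Δ
  Ec Fc : Fin 4 → ℤ
  Ec i = seq (Basis.E u v e f basis i) 4
  Fc i = seq (Basis.F u v e f basis i) 4
  det-symmetric : ∀ e0 e1 e2 e3 f0 f1 f2 f3 →
    let A = e0 * e0 + (e1 * e1 + (e2 * e2 + e3 * e3))
        B = e0 * f0 + (e1 * f1 + (e2 * f2 + e3 * f3))
        B′ = f0 * e0 + (f1 * e1 + (f2 * e2 + f3 * e3))
        C = f0 * f0 + (f1 * f1 + (f2 * f2 + f3 * f3))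
    in A * C + - (B * B) ≡ C * A + - (B′ * B′)
  det-symmetric = solve-∀
  2∣C : Div 1 (seq (Basis.C u v e f basis) 4)
  2∣C = Basis.Saturation.A-even u v f e (IsZ2Basis-swap {u} {v} {e} {f} basis)
    (subst (Div 2) (det-symmetric (Ec i0) (Ec i1) (Ec i2) (Ec i3) (Fc i0) (Fc i1) (Fc i2) (Fc i3)) 4∣Δ)

glue-forms : ∀ u v e f (basis : IsZ2Basis u v e f) n → 1 ≤ n → n ≤ 3 →
  Div n (seq (Basis.Δ u v e f basis) 4) → ¬ Div (suc n) (seq (Basis.Δ u v e f basis) 4) →
  GlueForms n (n ∸ 1) (seq (Basis.A u v e f basis) 4) (seq (Basis.B u v e f basis) 4) (seq (Basis.C u v e f basis) 4)
glue-forms u v e f basis 1 _ _ 2∣Δ ¬4∣Δ = forms-n1 _ _ _ 2∣Δ ¬4∣Δ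
glue-forms u v e f basis 2 _ _ 4∣Δ _ =
  let (2∣A , 2∣B , 2∣C) = Gram-even u v e f basis 4∣Δ in forms-n2 2∣A 2∣B 2∣C
glue-forms u v e f basis 3 _ _ 8∣Δ ¬16∣Δ =
  let (2∣A , 2∣B , 2∣C) = Gram-even u v e f basis (Div-mono 2 3 (s≤s (s≤s z≤n)) 8∣Δ) in forms-n3 2∣A 2∣B 2∣C 8∣Δ ¬16∣Δ
glue-forms u v e f basis (suc (suc (suc (suc _)))) _ (s≤s (s≤s (s≤s ())))

ord₂≤3 : ∀ n D → 2 ℕ.^ n ℕD.∣ D → ¬ (D ℕ.% 16 ≡ 0) → n ≤ 3
ord₂≤3 0 _ _ _ = z≤n
ord₂≤3 1 _ _ _ = s≤s z≤n
ord₂≤3 2 _ _ _ = s≤s (s≤s z≤n)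
ord₂≤3 3 _ _ _ = s≤s (s≤s (s≤s z≤n))
ord₂≤3 (suc (suc (suc (suc j)))) D (ℕD.divides q D≡) D≢0 =
  ⊥-elim (D≢0 (ℕD.n∣m⇒m%n≡0 D 16 (ℕD.divides (q ℕ.* 2 ℕ.^ j) (trans D≡ (regroup q (2 ℕ.^ j))))))
  where
  regroup : ∀ q x → q ℕ.* (2 ℕ.* (2 ℕ.* (2 ℕ.* (2 ℕ.* x)))) ≡ (q ℕ.* x) ℕ.* 16
  regroup = ℕ-solve-∀

odd-part-odd : ∀ n D q → D ≡ q ℕ.* 2 ℕ.^ n → ¬ (2 ℕ.^ suc n ℕD.∣ D) → ¬ Div 1 (+ q)
odd-part-odd n D q D≡ ¬2ⁿ⁺¹∣D (c , q≡) = ¬2ⁿ⁺¹∣D (ℕD.divides ℤ.∣ c ∣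
  (trans D≡ (trans (cong (ℕ._* 2 ℕ.^ n) (trans (cong ℤ.∣_∣ q≡) (ℤP.abs-* c (+ 2)))) (ℕP.*-assoc ℤ.∣ c ∣ 2 (2 ℕ.^ n)))))

proposition8p3 : (D n : ℕ) → InDD D → Ord2 D n → 0 < n →
    (u v : V4) → LinIndepQ u v → InRD2 D u v →
    GlueIso u v (n ∸ 1)
proposition8p3 D n (D≢0 , _) (2ⁿ∣D@(ℕD.divides q D≡) , ¬2ⁿ⁺¹∣D) 0<n u v _ (e , f , basis , t , t-unit , gram) =
  Basis.Glue.glue-iso u v e f basis n (n ∸ 1) 0<n n≤3 (ℕP.∸-monoˡ-≤ 1 n≤3) (fromℤ (+ q) *Z (t *Z t)) δ-unit Δ≃
    (glue-forms u v e f basis n 0<n n≤3 (proj₁ valuation) (proj₂ valuation))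
  where
  n≤3 : n ≤ 3
  n≤3 = ord₂≤3 n D 2ⁿ∣D D≢0
  δ-unit : IsUnitZ (fromℤ (+ q) *Z (t *Z t))
  δ-unit = odd-* (odd-part-odd n D q D≡ ¬2ⁿ⁺¹∣D) (odd-* t-unit t-unit)
  D≃ : fromℤ (+ D) ≃Z (pow2Z n *Z fromℤ (+ q))
  D≃ = ≃Z-pointwise λ _ → trans (cong +_ (trans D≡ (ℕP.*-comm q (2 ℕ.^ n)))) (ℤP.pos-* (2 ℕ.^ n) q)
  Δ≃ : Basis.Δ u v e f basis ≃Z (pow2Z n *Z (fromℤ (+ q) *Z (t *Z t)))
  Δ≃ = ≃Z-trans (ι-injective (≃Q-trans (≃Q-sym (Basis.gramDet≃Δ u v e f basis))
                                       (≈Q⇒≃Q {gramDet e f} {ι (fromℤ (+ D) *Z (t *Z t))} gram)))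
         (≃Z-trans (*Z-cong {fromℤ (+ D)} {pow2Z n *Z fromℤ (+ q)} {t *Z t} {t *Z t} D≃ (≃Z-refl (t *Z t))) (*Z-assoc (pow2Z n) (fromℤ (+ q)) (t *Z t)))
  valuation : Div n (seq (Basis.Δ u v e f basis) 4) × ¬ Div (suc n) (seq (Basis.Δ u v e f basis) 4)
  valuation = Cong-valuation n 4 (s≤s n≤3) (at Δ≃ 4) (unit-seq-odd (fromℤ (+ q) *Z (t *Z t)) 4 δ-unit (s≤s z≤n))
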